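{- For any positive integer $r$, $\mathrm{NCQSym}^r(\mathbf{x})$ is a Hopf algebra (with the product and coproduct of $\mathrm{NCQSym}(\mathbf{x})$; i.e. it is closed under them).
   Context: Noncommuting variables $\mathbf{x}_1,\mathbf{x}_2,\dots$. $\mathrm{NCQSym}(\mathbf{x})$ is the Hopf algebra of quasisymmetric functions in noncommuting variables: bounded-degree power series such that for every set composition $\Phi=(\Phi_1|\cdots|\Phi_k)$ of $[n]$ (sequence of disjoint nonempty sets with union $[n]$) all monomials $\mathbf{x}_{i_1}\cdots\mathbf{x}_{i_n}$ with $i_j=i_l$ for $j,l$ in a common block and $i_j<i_l$ for $j\in\Phi_p$, $l\in\Phi_q$, $p<q$ have equal coefficient. Product: product of power series. Coproduct: evaluate $f$ on $\mathbf{x}_1<\mathbf{x}_2<\cdots<\mathbf{y}_1<\mathbf{y}_2<\cdots$, impose $\mathbf{x}_i\mathbf{y}_j=\mathbf{y}_j\mathbf{x}_i$, write as $\sum f_1(\mathbf{x})f_2(\mathbf{y})$ and set $\Delta f=\sum f_1(\mathbf{x})\otimes f_2(\mathbf{x})$. An $r$-set-composition of $[n]$ is a pair $(\Phi,\Pi)$ with $\Phi$ a set composition of some $A\subseteq[n]$ all of whose blocks have size $\ge r$ and $\Pi$ a set partition of $[n]-A$ all of whose blocks have size $<r$. The $r$-dominant monomial function is $\mathbf{M}_{(\Phi,\Pi)}=\sum\mathbf{x}_{i_1}\cdots\mathbf{x}_{i_n}$ over all tuples with $i_j=i_k$ if and only if $j,k$ lie in the same block of $\Phi$ or of $\Pi$,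 and $i_j<i_k$ whenever $j\in\Phi_l$, $k\in\Phi_m$, $l<m$. $\mathrm{NCQSym}^r(\mathbf{x})=\bigoplus_{n\ge0}\mathrm{NCQSym}^r_n(\mathbf{x})$ with $\mathrm{NCQSym}^r_n(\mathbf{x})$ the $\mathbb{Q}$-span of the $\mathbf{M}_{(\Phi,\Pi)}$ over $r$-set-compositions of $[n]$. -}

module Defs where

open import Data.Nat as ℕ using (ℕ; zero; suc; _≤_; _<_; _⊔_; _≟_)
open import Data.Fin as Fin using (Fin)
open import Data.Bool using (Bool; true; false; _∧_; if_then_else_)
open import Data.List as List using (List; []; _∷_; _++_; map; concat; length; allFin; take; drop; upTo; foldr)
open import Data.List.Relation.Unary.All using (All)
open import Data.List.Relation.Binary.Permutation.Propositional using (_↭_)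
open import Data.Product using (Σ; _×_; _,_; ∃-syntax)
open import Data.Rational as ℚ using (ℚ; 0ℚ; 1ℚ)
open import Relation.Nullary using (yes; no; does)
open import Relation.Binary.PropositionalEquality using (_≡_; sym)

-- Noncommutative power series in x₀, x₁, x₂, … (indexed by ℕ) with
-- rational coefficients: a series is its coefficient function on words
-- (monomials x_{i₁}⋯x_{iₙ} ↔ the list i₁ ∷ ⋯ ∷ iₙ ∷ []).

Series : Set
Series = List ℕ → ℚ

-- Elements of a (completed) tensor product of two copies: coefficient
-- of the monomial u(x) ⊗ v(x).
Series² : Set
Series² = List ℕ → List ℕ → ℚ

sumℚ : List ℚ → ℚ
sumℚ = foldr ℚ._+_ 0ℚ

-- r-set-compositions of [n] = Fin n.
-- Φ : the ordered list of blocks of the set composition of A,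
-- Π : the blocks of the set partition of [n] - A (listed in some order).

record RSetComp (r n : ℕ) : Set where
  field
    Φ : List (List (Fin n))
    Π : List (List (Fin n))
    -- the blocks of Φ and Π are pairwise disjoint, duplicate-free, and
    -- together cover [n]
    covers   : concat (Φ ++ Π) ↭ allFin n
    Φ-large  : All (λ b → r ≤ length b) Φ
    Π-nonempty : All (λ b → 1 ≤ length b) Π
    Π-small  : All (λ b → length b < r) Π

_∈ᵇ_ : ∀ {n} → Fin n → List (Fin n) → Bool
i ∈ᵇ []      = false
i ∈ᵇ (j ∷ b) = if does (i Fin.≟ j) then true else (i ∈ᵇ b)

anyᵇ : ∀ {A : Set} → (A → Bool) → List A → Bool
anyᵇ p []       = false
anyᵇ p (x ∷ xs) = if p x then true else anyᵇ p xs

allᵇ : ∀ {A : Set} → (A → Bool) → List A → Bool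
allᵇ p []       = true
allᵇ p (x ∷ xs) = p x ∧ allᵇ p xs

_==ᵇ_ : Bool → Bool → Bool
true  ==ᵇ b = b
false ==ᵇ true = false
false ==ᵇ false = true

-- The coefficient of the monomial x_{w 0} ⋯ x_{w (n-1)} in M_{(Φ,Π)}:
-- 1 iff  (w j = w k ⇔ j, k lie in a common block of Φ or of Π)  and
-- (w j < w k whenever j ∈ Φ_l, k ∈ Φ_m, l < m); 0 otherwise.

module _ {n : ℕ} (w : Fin n → ℕ) where

  sameBlockᵇ : List (List (Fin n)) → Fin n → Fin n → Bool
  sameBlockᵇ bs j k = anyᵇ (λ b → (j ∈ᵇ b) ∧ (k ∈ᵇ b)) bs

  eqOKᵇ : List (List (Fin n)) → Bool
  eqOKᵇ bs = allᵇ (λ j → allᵇ (λ k →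
               does (w j ≟ w k) ==ᵇ sameBlockᵇ bs j k) (allFin n)) (allFin n)

  ordOKᵇ : List (List (Fin n)) → Bool
  ordOKᵇ []       = true
  ordOKᵇ (b ∷ bs) =
    allᵇ (λ j → allᵇ (λ c → allᵇ (λ k → does (suc (w j) ℕ.≤? w k)) c) bs) b
    ∧ ordOKᵇ bs

  isMonomialOfᵇ : ∀ {r} → RSetComp r n → Bool
  isMonomialOfᵇ σ = eqOKᵇ (RSetComp.Φ σ ++ RSetComp.Π σ) ∧ ordOKᵇ (RSetComp.Φ σ)

M : ∀ {r n} → RSetComp r n → Series
M {n = n} σ w with length w ≟ n
... | no _  = 0ℚ
... | yes p = if isMonomialOfᵇ (λ j → List.lookup w (Fin.cast (sym p) j)) σ
                then 1ℚ else 0ℚ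

RTerm : ℕ → Set
RTerm r = Σ ℕ (λ n → RSetComp r n)

termSeries : ∀ {r} → RTerm r → Series
termSeries (n , σ) = M σ

InNCQSymʳ : ℕ → Series → Set
InNCQSymʳ r f =
  Σ (List (RTerm r × ℚ)) λ ts →
    ∀ w → f w ≡ sumℚ (map (λ { (t , c) → c ℚ.* termSeries t w }) ts)

-- NCQSym^r(x) ⊗ NCQSym^r(x), realised inside Series² (the map
-- f ⊗ g ↦ ((u , v) ↦ f u * g v) is injective on this tensor product).
InNCQSymʳ⊗NCQSymʳ : ℕ → Series² → Set
InNCQSymʳ⊗NCQSymʳ r F =
  Σ (List (RTerm r × RTerm r × ℚ)) λ ts →
    ∀ u v → F u v ≡ sumℚ (map (λ { (s , t , c) → c ℚ.* (termSeries s u ℚ.* termSeries t v) }) ts)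

oneSeries : Series
oneSeries []      = 1ℚ
oneSeries (_ ∷ _) = 0ℚ

_⋆_ : Series → Series → Series
(f ⋆ g) w = sumℚ (map (λ i → f (take i w) ℚ.* g (drop i w)) (upTo (suc (length w))))

shuffles : List ℕ → List ℕ → List (List ℕ)
shuffles []       ys       = ys ∷ []
shuffles (x ∷ xs) []       = (x ∷ xs) ∷ []
shuffles (x ∷ xs) (y ∷ ys) =
  map (x ∷_) (shuffles xs (y ∷ ys)) ++ map (y ∷_) (shuffles (x ∷ xs) ys)

maxℕ : List ℕ → ℕ
maxℕ = foldr _⊔_ 0

-- Evaluating f on the ordered alphabet x₀<x₁<⋯<y₀<y₁<⋯ and
-- letting the x's commute with the y's, the coefficient of u(x) v(y) is
-- the sum of the coefficients of f at all interleavings of u(x) and v(y).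
-- For f ∈ NCQSym(x) the coefficient of such a mixed word only depends on
-- its pattern, so we may realise the ordered alphabet by x_i ↦ x_i,
-- y_j ↦ x_{N+j} with N = 1 + max(u) (all letters of u are < N).
Δ : Series → Series²
Δ f u v = sumℚ (map f (shuffles u (map (suc (maxℕ u) ℕ.+_) v)))

-- An element of NCQSym^r is the same thing as a series of bounded degree whose
-- coefficients are invariant under every admissible relabelling of a word: an
-- injective relabelling of its letters that is strictly increasing on the letters
-- occurring at least r times (only these can fill a block of Φ).  Each M_(Φ,Π)
-- has both properties.  Conversely, every word z whose letters are < |z| has a
-- canonical r-set-composition σ(z) (its letters grouped by value, the large
-- groups ordered by value), the monomials of M_σ(z) are exactly the admissible
-- relabellings of z, and a series h with both properties equals
-- Σ_z h(z)/N(z) · M_σ(z), N(z) counting the z' with z a monomial of M_σ(z'):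
-- the z contributing at a word w all have h(z) = h(w) and N(z) = N(w), and
-- there are N(w) of them.
-- Both properties pass from f, g to f ⋆ g, because the factors of a word inherit
-- its admissible relabellings, and to each tensor factor of Δ f, because an
-- admissible relabelling of one shuffled word extends to one of every shuffle.
module Submission where

open import Defs
open import Data.Nat using (ℕ; _≤_)
open import Data.Product using (_×_)

open import Data.Nat using (zero; suc; _<_; _⊔_; _+_; _∸_; z≤n; s≤s; _≟_; _≤?_; _<?_)
import Data.Nat.Properties as ℕₚ
open import Data.Fin as Fin using (Fin)
import Data.Fin.Properties as Finₚ
open import Data.Bool using (Bool; true; false; _∧_; _∨_; not; if_then_else_; T)
open import Data.Bool.Properties using (∨-zeroʳ)
open import Data.List as List
  using (List; []; _∷_; _++_; _∷ʳ_; [_]; map; concat; length; allFin; take; drop; upTo; applyUpTo; filterᵇ; null; lookup; tabulate)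
import Data.List.Properties as Listₚ
open import Data.List.Membership.Propositional using (_∈_)
import Data.List.Membership.Propositional.Properties as ∈ₚ
open import Data.List.Relation.Unary.Any as Any using (here; there; any?)
open import Data.List.Relation.Unary.Any.Properties using (lookup-index)
open import Data.List.Relation.Unary.All as All using (All; []; _∷_)
import Data.List.Relation.Unary.All.Properties as Allₚ
open import Data.List.Relation.Binary.Permutation.Propositional using (_↭_; ↭-refl; ↭-sym; ↭-trans; prep; module PermutationReasoning)
import Data.List.Relation.Binary.Permutation.Propositional.Properties as ↭ₚ
open import Data.Product using (_,_; proj₁; proj₂; ∃; ∃₂)
open import Data.Sum using (_⊎_; inj₁; inj₂) renaming ([_,_] to [_,_]′)
open import Data.Empty using (⊥; ⊥-elim)
open import Data.Rational as ℚ using (ℚ; 0ℚ; 1ℚ)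
import Data.Rational.Properties as ℚₚ
open import Function using (_∘_; id; mk⇔)
open import Relation.Binary.Definitions using (tri<; tri≈; tri>)
open import Relation.Binary.PropositionalEquality using (_≡_; _≢_; refl; sym; trans; cong; cong₂; subst; subst₂; module ≡-Reasoning)
open import Relation.Nullary using (Dec; yes; no; does; ¬_)
open import Relation.Nullary.Decidable using (dec-true; dec-false; does-⇔; _⊎-dec_)

∧-≡true⁻ : ∀ {a b} → a ∧ b ≡ true → a ≡ true × b ≡ true
∧-≡true⁻ {true} {true} _ = refl , refl

∧-≡true⁺ : ∀ {a b} → a ≡ true → b ≡ true → a ∧ b ≡ true
∧-≡true⁺ refl refl = refl

∧-≡false⁺ : ∀ {a b} → (a ≡ true → b ≡ true → ⊥) → a ∧ b ≡ false
∧-≡false⁺ {false} _ = refl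
∧-≡false⁺ {true} {false} _ = refl
∧-≡false⁺ {true} {true} h = ⊥-elim (h refl refl)

∧-cong-guarded : ∀ {a a′ b b′} → a′ ≡ a → (a ≡ true → b′ ≡ b) → a′ ∧ b′ ≡ a ∧ b
∧-cong-guarded {false} refl _ = refl
∧-cong-guarded {true} refl h = h refl

not-≡true⁻ : ∀ {b} → not b ≡ true → b ≡ false
not-≡true⁻ {false} _ = refl

==ᵇ-≡true⁻ : ∀ {a b} → (a ==ᵇ b) ≡ true → a ≡ b
==ᵇ-≡true⁻ {true} {true} _ = refl
==ᵇ-≡true⁻ {false} {false} _ = refl

==ᵇ-refl : ∀ a → (a ==ᵇ a) ≡ true
==ᵇ-refl true = refl
==ᵇ-refl false = refl

false≢true : false ≢ true
false≢true ()

does≡true⇒ : ∀ {A : Set} (a? : Dec A) → does a? ≡ true → A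
does≡true⇒ (yes a) _ = a

does≡false⇒ : ∀ {A : Set} (a? : Dec A) → does a? ≡ false → ¬ A
does≡false⇒ (no ¬a) _ = ¬a

≟-refl : ∀ a → does (a ≟ a) ≡ true
≟-refl a = dec-true (a ≟ a) refl

≟-≡true⁻ : ∀ {a b} → does (a ≟ b) ≡ true → a ≡ b
≟-≡true⁻ {a} {b} = does≡true⇒ (a ≟ b)

module _ {A : Set} where

  allᵇ-cong : ∀ {p q : A → Bool} xs → (∀ {x} → x ∈ xs → p x ≡ q x) → allᵇ p xs ≡ allᵇ q xs
  allᵇ-cong [] h = refl
  allᵇ-cong (x ∷ xs) h = cong₂ _∧_ (h (here refl)) (allᵇ-cong xs (h ∘ there))

  allᵇ-≡true⁻ : ∀ {p : A → Bool} {xs x} → allᵇ p xs ≡ true → x ∈ xs → p x ≡ true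
  allᵇ-≡true⁻ {p} {y ∷ _} e (here refl) = proj₁ (∧-≡true⁻ {p y} e)
  allᵇ-≡true⁻ {p} {y ∷ _} e (there m) = allᵇ-≡true⁻ (proj₂ (∧-≡true⁻ {p y} e)) m

  allᵇ-≡true⁺ : ∀ {p : A → Bool} xs → (∀ {x} → x ∈ xs → p x ≡ true) → allᵇ p xs ≡ true
  allᵇ-≡true⁺ [] h = refl
  allᵇ-≡true⁺ (x ∷ xs) h = ∧-≡true⁺ (h (here refl)) (allᵇ-≡true⁺ xs (h ∘ there))

  anyᵇ-≡true⁺ : ∀ {p : A → Bool} {xs x} → x ∈ xs → p x ≡ true → anyᵇ p xs ≡ true
  anyᵇ-≡true⁺ (here refl) e rewrite e = refl
  anyᵇ-≡true⁺ {p} {y ∷ _} (there m) e with p y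
  ... | true = refl
  ... | false = anyᵇ-≡true⁺ m e

  anyᵇ-≡false⁺ : ∀ {p : A → Bool} xs → (∀ {x} → x ∈ xs → p x ≡ false) → anyᵇ p xs ≡ false
  anyᵇ-≡false⁺ [] h = refl
  anyᵇ-≡false⁺ (x ∷ xs) h rewrite h (here refl) = anyᵇ-≡false⁺ xs (h ∘ there)

  anyᵇ-cong : ∀ {p q : A → Bool} xs → (∀ {x} → x ∈ xs → p x ≡ q x) → anyᵇ p xs ≡ anyᵇ q xs
  anyᵇ-cong [] h = refl
  anyᵇ-cong {q = q} (x ∷ xs) h rewrite h (here refl) with q x
  ... | true = refl
  ... | false = anyᵇ-cong xs (h ∘ there)

  anyᵇ-++ : ∀ (p : A → Bool) xs ys → anyᵇ p (xs ++ ys) ≡ anyᵇ p xs ∨ anyᵇ p ys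
  anyᵇ-++ p [] ys = refl
  anyᵇ-++ p (x ∷ xs) ys with p x
  ... | true = refl
  ... | false = anyᵇ-++ p xs ys

  anyᵇ-map : ∀ {B : Set} (p : B → Bool) (f : A → B) xs → anyᵇ p (map f xs) ≡ anyᵇ (p ∘ f) xs
  anyᵇ-map p f [] = refl
  anyᵇ-map p f (x ∷ xs) with p (f x)
  ... | true = refl
  ... | false = anyᵇ-map p f xs

  anyᵇ-filterᵇ : ∀ (p q : A → Bool) xs → (∀ x → q x ≡ false → p x ≡ false) → anyᵇ p (filterᵇ q xs) ≡ anyᵇ p xs
  anyᵇ-filterᵇ p q [] h = refl
  anyᵇ-filterᵇ p q (x ∷ xs) h with q x in e
  ... | false rewrite h x e = anyᵇ-filterᵇ p q xs h
  ... | true with p x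
  ...   | true = refl
  ...   | false = anyᵇ-filterᵇ p q xs h

  anyᵇ-partition : ∀ (p q : A → Bool) xs → anyᵇ p (filterᵇ q xs) ∨ anyᵇ p (filterᵇ (not ∘ q) xs) ≡ anyᵇ p xs
  anyᵇ-partition p q [] = refl
  anyᵇ-partition p q (x ∷ xs) with q x
  ... | true with p x
  ...   | true = refl
  ...   | false = anyᵇ-partition p q xs
  anyᵇ-partition p q (x ∷ xs) | false with p x
  ...   | true = ∨-zeroʳ (anyᵇ p (filterᵇ q xs))
  ...   | false = anyᵇ-partition p q xs

∈ᵇ≡does-any? : ∀ {n} (i : Fin n) b → (i ∈ᵇ b) ≡ does (any? (i Fin.≟_) b)
∈ᵇ≡does-any? i [] = refl
∈ᵇ≡does-any? i (j ∷ b) with i Fin.≟ j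
... | yes _ = refl
... | no _ = ∈ᵇ≡does-any? i b

∈⇒∈ᵇ : ∀ {n} {i : Fin n} {b} → i ∈ b → (i ∈ᵇ b) ≡ true
∈⇒∈ᵇ {i = i} {b} m = trans (∈ᵇ≡does-any? i b) (dec-true (any? (i Fin.≟_) b) m)

countᵇ : ∀ {A : Set} → (A → Bool) → List A → ℕ
countᵇ p = length ∘ filterᵇ p

module _ {A : Set} where

  ∈-filterᵇ⁻ : ∀ {p : A → Bool} xs {x} → x ∈ filterᵇ p xs → x ∈ xs × p x ≡ true
  ∈-filterᵇ⁻ {p} (y ∷ xs) m with p y in e
  ∈-filterᵇ⁻ (y ∷ xs) (here refl) | true = here refl , e
  ∈-filterᵇ⁻ (y ∷ xs) (there m) | true = let (m′ , px) = ∈-filterᵇ⁻ xs m in there m′ , px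
  ... | false = let (m′ , px) = ∈-filterᵇ⁻ xs m in there m′ , px

  ∈-filterᵇ⁺ : ∀ {p : A → Bool} {xs x} → x ∈ xs → p x ≡ true → x ∈ filterᵇ p xs
  ∈-filterᵇ⁺ (here refl) e rewrite e = here refl
  ∈-filterᵇ⁺ {p} {y ∷ _} (there m) e with p y
  ... | true = there (∈-filterᵇ⁺ m e)
  ... | false = ∈-filterᵇ⁺ m e

  All-filterᵇ : ∀ {P : A → Set} {p : A → Bool} xs → (∀ {x} → x ∈ xs → p x ≡ true → P x) → All P (filterᵇ p xs)
  All-filterᵇ [] h = []
  All-filterᵇ {p = p} (x ∷ xs) h with p x in e
  ... | true = h (here refl) e ∷ All-filterᵇ xs (h ∘ there)
  ... | false = All-filterᵇ xs (h ∘ there)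

  filterᵇ-cong : ∀ {p q : A → Bool} xs → (∀ {x} → x ∈ xs → p x ≡ q x) → filterᵇ p xs ≡ filterᵇ q xs
  filterᵇ-cong [] h = refl
  filterᵇ-cong {q = q} (x ∷ xs) h rewrite h (here refl) with q x
  ... | true = cong (x ∷_) (filterᵇ-cong xs (h ∘ there))
  ... | false = filterᵇ-cong xs (h ∘ there)

  filterᵇ-all : ∀ {p : A → Bool} xs → (∀ {x} → x ∈ xs → p x ≡ true) → filterᵇ p xs ≡ xs
  filterᵇ-all [] h = refl
  filterᵇ-all (x ∷ xs) h rewrite h (here refl) = cong (x ∷_) (filterᵇ-all xs (h ∘ there))

  filterᵇ-++-disjoint : ∀ (p q : A → Bool) xs → (∀ {x} → x ∈ xs → p x ≡ true → q x ≡ false) →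
    filterᵇ p xs ++ filterᵇ q xs ↭ filterᵇ (λ x → p x ∨ q x) xs
  filterᵇ-++-disjoint p q [] h = ↭-refl
  filterᵇ-++-disjoint p q (x ∷ xs) h with p x in ep | q x in eq
  ... | true  | true  = ⊥-elim (false≢true (trans (sym (h (here refl) ep)) eq))
  ... | true  | false = prep x (filterᵇ-++-disjoint p q xs (h ∘ there))
  ... | false | true  = ↭-trans (↭ₚ.shift x (filterᵇ p xs) _) (prep x (filterᵇ-++-disjoint p q xs (h ∘ there)))
  ... | false | false = filterᵇ-++-disjoint p q xs (h ∘ there)

  countᵇ-++ : ∀ (p : A → Bool) xs ys → countᵇ p (xs ++ ys) ≡ countᵇ p xs + countᵇ p ys
  countᵇ-++ p xs ys = trans (cong length (Listₚ.filter-++ _ xs ys)) (Listₚ.length-++ (filterᵇ p xs))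

  countᵇ-↭ : ∀ (p : A → Bool) {xs ys} → xs ↭ ys → countᵇ p xs ≡ countᵇ p ys
  countᵇ-↭ p xs↭ys = ↭ₚ.↭-length (↭ₚ.filter-↭ _ xs↭ys)

  countᵇ-map : ∀ {B : Set} (p : B → Bool) (f : A → B) xs → countᵇ p (map f xs) ≡ countᵇ (p ∘ f) xs
  countᵇ-map p f [] = refl
  countᵇ-map p f (x ∷ xs) with p (f x)
  ... | true = cong suc (countᵇ-map p f xs)
  ... | false = countᵇ-map p f xs

  countᵇ-cong : ∀ {p q : A → Bool} xs → (∀ {x} → x ∈ xs → p x ≡ q x) → countᵇ p xs ≡ countᵇ q xs
  countᵇ-cong xs h = cong length (filterᵇ-cong xs h)

  countᵇ-all : ∀ {p : A → Bool} xs → (∀ {x} → x ∈ xs → p x ≡ true) → countᵇ p xs ≡ length xs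
  countᵇ-all xs h = cong length (filterᵇ-all xs h)

  countᵇ-none : ∀ {p : A → Bool} xs → (∀ {x} → x ∈ xs → p x ≡ false) → countᵇ p xs ≡ 0
  countᵇ-none [] h = refl
  countᵇ-none (x ∷ xs) h rewrite h (here refl) = countᵇ-none xs (h ∘ there)

  countᵇ-< : ∀ {p : A → Bool} {xs x} → x ∈ xs → p x ≡ false → countᵇ p xs < length xs
  countᵇ-< {xs = xs} m e = Listₚ.filter-notAll _ xs (Any.map (λ { refl t → subst T e t }) m)

  countᵇ-concat : ∀ (p : A → Bool) {b bs} → b ∈ bs → countᵇ p b ≤ countᵇ p (concat bs)
  countᵇ-concat p {b} {c ∷ bs} m = subst (countᵇ p b ≤_) (sym (countᵇ-++ p c (concat bs))) (lemma m)
    where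
    lemma : b ∈ c ∷ bs → countᵇ p b ≤ countᵇ p c + countᵇ p (concat bs)
    lemma (here refl) = ℕₚ.m≤m+n _ _
    lemma (there m) = ℕₚ.≤-trans (countᵇ-concat p m) (ℕₚ.m≤n+m _ _)

  countᵇ-mono-≤ : ∀ {p q : A → Bool} xs → (∀ {y} → y ∈ xs → p y ≡ true → q y ≡ true) → countᵇ p xs ≤ countᵇ q xs
  countᵇ-mono-≤ [] h = z≤n
  countᵇ-mono-≤ {p} {q} (x ∷ xs) h with p x in ep | q x in eq
  ... | true  | true  = s≤s (countᵇ-mono-≤ xs (h ∘ there))
  ... | true  | false = ⊥-elim (false≢true (trans (sym eq) (h (here refl) ep)))
  ... | false | true  = ℕₚ.m≤n⇒m≤1+n (countᵇ-mono-≤ xs (h ∘ there))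
  ... | false | false = countᵇ-mono-≤ xs (h ∘ there)

  countᵇ-mono-< : ∀ {p q : A → Bool} xs → (∀ {y} → y ∈ xs → p y ≡ true → q y ≡ true) →
    ∀ {x} → x ∈ xs → p x ≡ false → q x ≡ true → countᵇ p xs < countᵇ q xs
  countᵇ-mono-< {p} {q} (x ∷ xs) h (here refl) px qx rewrite px | qx = s≤s (countᵇ-mono-≤ xs (h ∘ there))
  countᵇ-mono-< {p} {q} (y ∷ xs) h (there m) px qx with p y in ep | q y in eq
  ... | true  | true  = s≤s (countᵇ-mono-< xs (h ∘ there) m px qx)
  ... | true  | false = ⊥-elim (false≢true (trans (sym eq) (h (here refl) ep)))
  ... | false | true  = ℕₚ.m≤n⇒m≤1+n (countᵇ-mono-< xs (h ∘ there) m px qx)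
  ... | false | false = countᵇ-mono-< xs (h ∘ there) m px qx

  concat-partition : ∀ (p : List A → Bool) xss → concat (filterᵇ p xss) ++ concat (filterᵇ (not ∘ p) xss) ↭ concat xss
  concat-partition p [] = ↭-refl
  concat-partition p (xs ∷ xss) with p xs
  ... | true = subst (_↭ xs ++ concat xss) (sym (Listₚ.++-assoc xs (concat (filterᵇ p xss)) _))
                 (↭ₚ.++⁺ˡ xs (concat-partition p xss))
  ... | false = ↭-trans (↭ₚ.shifts (concat (filterᵇ p xss)) xs) (↭ₚ.++⁺ˡ xs (concat-partition p xss))

  concat-filterᵇ-nonempty : ∀ xss → concat (filterᵇ (not ∘ null) xss) ≡ concat {A = A} xss
  concat-filterᵇ-nonempty [] = refl
  concat-filterᵇ-nonempty ([] ∷ xss) = concat-filterᵇ-nonempty xss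
  concat-filterᵇ-nonempty ((x ∷ xs) ∷ xss) = cong ((x ∷ xs) ++_) (concat-filterᵇ-nonempty xss)

<-suc⇔<∨≡ : ∀ m n → does (m <? n) ∨ does (m ≟ n) ≡ does (m <? suc n)
<-suc⇔<∨≡ m n = does-⇔ (mk⇔ [ ℕₚ.m≤n⇒m≤1+n , (λ { refl → ℕₚ.n<1+n m }) ]′ ℕₚ.m<1+n⇒m<n∨m≡n)
                        ((m <? n) ⊎-dec (m ≟ n)) (m <? suc n)

group-by-key : ∀ {A : Set} (key : A → ℕ) xs B →
  concat (map (λ v → filterᵇ (λ x → does (key x ≟ v)) xs) (upTo B)) ↭ filterᵇ (λ x → does (key x <? B)) xs
group-by-key key xs zero = subst (concat [] ↭_) (sym (filterᵇ-none xs)) ↭-refl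
  where
  filterᵇ-none : ∀ ys → filterᵇ (λ x → does (key x <? 0)) ys ≡ []
  filterᵇ-none [] = refl
  filterᵇ-none (_ ∷ ys) = filterᵇ-none ys
group-by-key {A} key xs (suc B) = begin
    concat (map bucket (upTo (suc B)))
  ≡⟨ cong (concat ∘ map bucket) (sym (Listₚ.upTo-∷ʳ B)) ⟩
    concat (map bucket (upTo B ∷ʳ B))
  ≡⟨ cong concat (Listₚ.map-++ bucket (upTo B) [ B ]) ⟩
    concat (map bucket (upTo B) ++ [ bucket B ])
  ≡⟨ sym (Listₚ.concat-++ (map bucket (upTo B)) [ bucket B ]) ⟩
    concat (map bucket (upTo B)) ++ bucket B ++ []
  ≡⟨ cong (concat (map bucket (upTo B)) ++_) (Listₚ.++-identityʳ (bucket B)) ⟩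
    concat (map bucket (upTo B)) ++ bucket B
  ↭⟨ ↭ₚ.++⁺ʳ (bucket B) (group-by-key key xs B) ⟩
    filterᵇ (λ x → does (key x <? B)) xs ++ bucket B
  ↭⟨ filterᵇ-++-disjoint _ _ xs (λ {x} _ x<B →
       dec-false (key x ≟ B) (λ { refl → ℕₚ.<-irrefl refl (does≡true⇒ (key x <? B) x<B) })) ⟩
    filterᵇ (λ x → does (key x <? B) ∨ does (key x ≟ B)) xs
  ≡⟨ filterᵇ-cong xs (λ {x} _ → <-suc⇔<∨≡ (key x) B) ⟩
    filterᵇ (λ x → does (key x <? suc B)) xs ∎
  where
  open PermutationReasoning
  bucket : ℕ → List A
  bucket v = filterᵇ (λ x → does (key x ≟ v)) xs

data Before {A : Set} (b c : A) : List A → Set where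
  here  : ∀ {xs} → c ∈ xs → Before b c (b ∷ xs)
  there : ∀ {y xs} → Before b c xs → Before b c (y ∷ xs)

module _ {A : Set} where

  Before-map⁺ : ∀ {B : Set} (f : A → B) {a a′ xs} → Before a a′ xs → Before (f a) (f a′) (map f xs)
  Before-map⁺ f (here m) = here (∈ₚ.∈-map⁺ f m)
  Before-map⁺ f (there bf) = there (Before-map⁺ f bf)

  Before-map⁻ : ∀ {B : Set} (f : A → B) {b c} xs → Before b c (map f xs) →
    ∃₂ λ a a′ → b ≡ f a × c ≡ f a′ × Before a a′ xs
  Before-map⁻ f (x ∷ xs) (here m) = let (a′ , a′∈xs , e) = ∈ₚ.∈-map⁻ f m in x , a′ , refl , e , here a′∈xs
  Before-map⁻ f (x ∷ xs) (there bf) = let (a , a′ , e , e′ , bf′) = Before-map⁻ f xs bf in a , a′ , e , e′ , there bf′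

  Before-filterᵇ⁺ : ∀ {p : A → Bool} {b c xs} → Before b c xs → p b ≡ true → p c ≡ true → Before b c (filterᵇ p xs)
  Before-filterᵇ⁺ (here m) pb pc rewrite pb = here (∈-filterᵇ⁺ m pc)
  Before-filterᵇ⁺ {p} {xs = y ∷ _} (there bf) pb pc with p y
  ... | true = there (Before-filterᵇ⁺ bf pb pc)
  ... | false = Before-filterᵇ⁺ bf pb pc

  Before-filterᵇ⁻ : ∀ {p : A → Bool} {b c} xs → Before b c (filterᵇ p xs) → Before b c xs
  Before-filterᵇ⁻ {p} (y ∷ xs) bf with p y
  Before-filterᵇ⁻ (y ∷ xs) (here m) | true = here (proj₁ (∈-filterᵇ⁻ xs m))
  Before-filterᵇ⁻ (y ∷ xs) (there bf) | true = there (Before-filterᵇ⁻ xs bf)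
  ... | false = there (Before-filterᵇ⁻ xs bf)

  Before-applyUpTo⁺ : ∀ (f : ℕ → A) {i j k} → i < j → j < k → Before (f i) (f j) (applyUpTo f k)
  Before-applyUpTo⁺ f {zero} {suc j} {suc k} _ (s≤s j<k) = here (∈ₚ.∈-applyUpTo⁺ (f ∘ suc) j<k)
  Before-applyUpTo⁺ f {suc i} {suc j} {suc k} (s≤s i<j) (s≤s j<k) = there (Before-applyUpTo⁺ (f ∘ suc) i<j j<k)

  Before-applyUpTo⁻ : ∀ (f : ℕ → A) {b c} k → Before b c (applyUpTo f k) → ∃₂ λ i j → i < j × b ≡ f i × c ≡ f j
  Before-applyUpTo⁻ f (suc k) (here m) =
    let (j , _ , e) = ∈ₚ.∈-applyUpTo⁻ (f ∘ suc) m in 0 , suc j , s≤s z≤n , refl , e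
  Before-applyUpTo⁻ f (suc k) (there bf) =
    let (i , j , i<j , e , e′) = Before-applyUpTo⁻ (f ∘ suc) k bf in suc i , suc j , s≤s i<j , e , e′

Before-upTo⁻ : ∀ {a a′} B → Before a a′ (upTo B) → a < a′
Before-upTo⁻ B bf with Before-applyUpTo⁻ id B bf
... | _ , _ , i<j , refl , refl = i<j

shuffles-↭ : ∀ xs ys {s} → s ∈ shuffles xs ys → s ↭ xs ++ ys
shuffles-↭ [] ys (here refl) = ↭-refl
shuffles-↭ (x ∷ xs) [] (here refl) = ↭-sym (↭ₚ.++-identityʳ (x ∷ xs))
shuffles-↭ (x ∷ xs) (y ∷ ys) m with ∈ₚ.∈-++⁻ (map (x ∷_) (shuffles xs (y ∷ ys))) m
... | inj₁ m₁ with ∈ₚ.∈-map⁻ (x ∷_) m₁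
...   | _ , m′ , refl = prep x (shuffles-↭ xs (y ∷ ys) m′)
shuffles-↭ (x ∷ xs) (y ∷ ys) m | inj₂ m₂ with ∈ₚ.∈-map⁻ (y ∷_) m₂
...   | _ , m′ , refl = ↭-trans (prep y (shuffles-↭ (x ∷ xs) ys m′)) (↭-sym (↭ₚ.shift y (x ∷ xs) ys))

shuffles-map : ∀ (g : ℕ → ℕ) xs ys → shuffles (map g xs) (map g ys) ≡ map (map g) (shuffles xs ys)
shuffles-map g [] ys = refl
shuffles-map g (x ∷ xs) [] = refl
shuffles-map g (x ∷ xs) (y ∷ ys) = begin
    map (g x ∷_) (shuffles (map g xs) (map g (y ∷ ys))) ++ map (g y ∷_) (shuffles (map g (x ∷ xs)) (map g ys))
  ≡⟨ cong₂ (λ l l′ → map (g x ∷_) l ++ map (g y ∷_) l′) (shuffles-map g xs (y ∷ ys)) (shuffles-map g (x ∷ xs) ys) ⟩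
    map (g x ∷_) (map (map g) (shuffles xs (y ∷ ys))) ++ map (g y ∷_) (map (map g) (shuffles (x ∷ xs) ys))
  ≡⟨ cong₂ _++_ (sym (Listₚ.map-∘ (shuffles xs (y ∷ ys)))) (sym (Listₚ.map-∘ (shuffles (x ∷ xs) ys))) ⟩
    map (map g ∘ (x ∷_)) (shuffles xs (y ∷ ys)) ++ map (map g ∘ (y ∷_)) (shuffles (x ∷ xs) ys)
  ≡⟨ cong₂ _++_ (Listₚ.map-∘ (shuffles xs (y ∷ ys))) (Listₚ.map-∘ (shuffles (x ∷ xs) ys)) ⟩
    map (map g) (map (x ∷_) (shuffles xs (y ∷ ys))) ++ map (map g) (map (y ∷_) (shuffles (x ∷ xs) ys))
  ≡⟨ sym (Listₚ.map-++ (map g) (map (x ∷_) (shuffles xs (y ∷ ys))) _) ⟩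
    map (map g) (shuffles (x ∷ xs) (y ∷ ys)) ∎
  where open ≡-Reasoning

maxℕ-≥ : ∀ {a xs} → a ∈ xs → a ≤ maxℕ xs
maxℕ-≥ {xs = x ∷ xs} (here refl) = ℕₚ.m≤m⊔n x (maxℕ xs)
maxℕ-≥ {xs = x ∷ xs} (there m) = ℕₚ.≤-trans (maxℕ-≥ m) (ℕₚ.m≤n⊔m x (maxℕ xs))

sumℚ-++ : ∀ xs ys → sumℚ (xs ++ ys) ≡ sumℚ xs ℚ.+ sumℚ ys
sumℚ-++ [] ys = sym (ℚₚ.+-identityˡ _)
sumℚ-++ (x ∷ xs) ys = trans (cong (x ℚ.+_) (sumℚ-++ xs ys)) (sym (ℚₚ.+-assoc x _ _))

sumℚ-map-++ : ∀ {A : Set} (f : A → ℚ) xs ys → sumℚ (map f (xs ++ ys)) ≡ sumℚ (map f xs) ℚ.+ sumℚ (map f ys)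
sumℚ-map-++ f xs ys = trans (cong sumℚ (Listₚ.map-++ f xs ys)) (sumℚ-++ (map f xs) (map f ys))

module _ {A : Set} where

  sumℚ-map-cong : ∀ {f g : A → ℚ} xs → (∀ {x} → x ∈ xs → f x ≡ g x) → sumℚ (map f xs) ≡ sumℚ (map g xs)
  sumℚ-map-cong [] h = refl
  sumℚ-map-cong (x ∷ xs) h = cong₂ ℚ._+_ (h (here refl)) (sumℚ-map-cong xs (h ∘ there))

  sumℚ-map-zero : ∀ {f : A → ℚ} xs → (∀ {x} → x ∈ xs → f x ≡ 0ℚ) → sumℚ (map f xs) ≡ 0ℚ
  sumℚ-map-zero [] h = refl
  sumℚ-map-zero (x ∷ xs) h = cong₂ ℚ._+_ (h (here refl)) (sumℚ-map-zero xs (h ∘ there))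

  sumℚ-map-*ˡ : ∀ k (f : A → ℚ) xs → sumℚ (map (λ x → k ℚ.* f x) xs) ≡ k ℚ.* sumℚ (map f xs)
  sumℚ-map-*ˡ k f [] = sym (ℚₚ.*-zeroʳ k)
  sumℚ-map-*ˡ k f (x ∷ xs) = trans (cong (k ℚ.* f x ℚ.+_) (sumℚ-map-*ˡ k f xs)) (sym (ℚₚ.*-distribˡ-+ k (f x) _))

  sumℚ-map-*ʳ : ∀ k (f : A → ℚ) xs → sumℚ (map (λ x → f x ℚ.* k) xs) ≡ sumℚ (map f xs) ℚ.* k
  sumℚ-map-*ʳ k f [] = sym (ℚₚ.*-zeroˡ k)
  sumℚ-map-*ʳ k f (x ∷ xs) = trans (cong (f x ℚ.* k ℚ.+_) (sumℚ-map-*ʳ k f xs)) (sym (ℚₚ.*-distribʳ-+ k (f x) _))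

  sumℚ-map-∘ : ∀ {B : Set} (f : B → ℚ) (g : A → B) xs → sumℚ (map f (map g xs)) ≡ sumℚ (map (f ∘ g) xs)
  sumℚ-map-∘ f g xs = cong sumℚ (sym (Listₚ.map-∘ xs))

  sumℚ-concatMap : ∀ {B : Set} (f : B → ℚ) (g : A → List B) xs →
    sumℚ (map f (concat (map g xs))) ≡ sumℚ (map (λ a → sumℚ (map f (g a))) xs)
  sumℚ-concatMap f g [] = refl
  sumℚ-concatMap f g (x ∷ xs) = trans (sumℚ-map-++ f (g x) _) (cong (sumℚ (map f (g x)) ℚ.+_) (sumℚ-concatMap f g xs))

  sumℚ-map-nonneg : ∀ {f : A → ℚ} xs → (∀ {x} → x ∈ xs → 0ℚ ℚ.≤ f x) → 0ℚ ℚ.≤ sumℚ (map f xs)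
  sumℚ-map-nonneg [] h = ℚₚ.≤-refl
  sumℚ-map-nonneg (x ∷ xs) h = ℚₚ.+-mono-≤ (h (here refl)) (sumℚ-map-nonneg xs (h ∘ there))

  sumℚ-map-≥1 : ∀ {f : A → ℚ} xs → (∀ {x} → x ∈ xs → 0ℚ ℚ.≤ f x) →
    ∀ {y} → y ∈ xs → 1ℚ ℚ.≤ f y → 1ℚ ℚ.≤ sumℚ (map f xs)
  sumℚ-map-≥1 (x ∷ xs) h (here refl) 1≤fx = ℚₚ.+-mono-≤ 1≤fx (sumℚ-map-nonneg xs (h ∘ there))
  sumℚ-map-≥1 (x ∷ xs) h (there m) 1≤fy = ℚₚ.+-mono-≤ (h (here refl)) (sumℚ-map-≥1 xs (h ∘ there) m 1≤fy)

  sumℚ-map-*-*-rearrange : ∀ (a m′ : A → ℚ) k m xs →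
    (sumℚ (map (λ x → a x ℚ.* m′ x) xs) ℚ.* k) ℚ.* m ≡ sumℚ (map (λ x → (a x ℚ.* k) ℚ.* (m ℚ.* m′ x)) xs)
  sumℚ-map-*-*-rearrange a m′ k m xs = begin
      (sumℚ (map (λ x → a x ℚ.* m′ x) xs) ℚ.* k) ℚ.* m
    ≡⟨ cong (ℚ._* m) (sym (sumℚ-map-*ʳ k (λ x → a x ℚ.* m′ x) xs)) ⟩
      sumℚ (map (λ x → (a x ℚ.* m′ x) ℚ.* k) xs) ℚ.* m
    ≡⟨ sym (sumℚ-map-*ʳ m (λ x → (a x ℚ.* m′ x) ℚ.* k) xs) ⟩
      sumℚ (map (λ x → ((a x ℚ.* m′ x) ℚ.* k) ℚ.* m) xs)
    ≡⟨ sumℚ-map-cong xs (λ {x} _ → rearrange (a x) (m′ x)) ⟩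
      sumℚ (map (λ x → (a x ℚ.* k) ℚ.* (m ℚ.* m′ x)) xs) ∎
    where
    open ≡-Reasoning
    rearrange : ∀ b n → ((b ℚ.* n) ℚ.* k) ℚ.* m ≡ (b ℚ.* k) ℚ.* (m ℚ.* n)
    rearrange b n = begin
      ((b ℚ.* n) ℚ.* k) ℚ.* m ≡⟨ cong (ℚ._* m) (ℚₚ.*-assoc b n k) ⟩
      (b ℚ.* (n ℚ.* k)) ℚ.* m ≡⟨ cong (λ t → (b ℚ.* t) ℚ.* m) (ℚₚ.*-comm n k) ⟩
      (b ℚ.* (k ℚ.* n)) ℚ.* m ≡⟨ cong (ℚ._* m) (sym (ℚₚ.*-assoc b k n)) ⟩
      ((b ℚ.* k) ℚ.* n) ℚ.* m ≡⟨ ℚₚ.*-assoc (b ℚ.* k) n m ⟩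
      (b ℚ.* k) ℚ.* (n ℚ.* m) ≡⟨ cong ((b ℚ.* k) ℚ.*_) (ℚₚ.*-comm n m) ⟩
      (b ℚ.* k) ℚ.* (m ℚ.* n) ∎

-- 1/q, with the junk value 0 at q = 0.
inv₀ : ℚ → ℚ
inv₀ q with q ℚ.≟ 0ℚ
... | yes _ = 0ℚ
... | no q≢0 = ℚ.1/_ q {{ℚ.≢-nonZero q≢0}}

inv₀-inverseˡ : ∀ q → q ≢ 0ℚ → inv₀ q ℚ.* q ≡ 1ℚ
inv₀-inverseˡ q q≢0 with q ℚ.≟ 0ℚ
... | yes q≡0 = ⊥-elim (q≢0 q≡0)
... | no q≢0′ = ℚₚ.*-inverseˡ q {{ℚ.≢-nonZero q≢0′}}

occurrences : List ℕ → ℕ → ℕ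
occurrences w a = countᵇ (λ z → does (z ≟ a)) w

-- Only letters occurring at least r times can fill a block of Φ; their relative
-- order is what M_(Φ,Π) sees, while the other letters need only stay distinct.
record Admissible (r : ℕ) (φ : ℕ → ℕ) (w : List ℕ) : Set where
  field
    injective : ∀ {a b} → a ∈ w → b ∈ w → φ a ≡ φ b → a ≡ b
    monotone  : ∀ {a b} → a ∈ w → b ∈ w → r ≤ occurrences w a → r ≤ occurrences w b → a < b → φ a < φ b
open Admissible

module _ {r : ℕ} {φ : ℕ → ℕ} where

  strictMono⇒Admissible : ∀ {w} → (∀ {a b} → a ∈ w → b ∈ w → a < b → φ a < φ b) → Admissible r φ w
  strictMono⇒Admissible {w} mono = record { injective = inj ; monotone = λ a∈w b∈w _ _ → mono a∈w b∈w }
    where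
    inj : ∀ {a b} → a ∈ w → b ∈ w → φ a ≡ φ b → a ≡ b
    inj {a} {b} a∈w b∈w e with ℕₚ.<-cmp a b
    ... | tri< a<b _ _ = ⊥-elim (ℕₚ.<-irrefl e (mono a∈w b∈w a<b))
    ... | tri≈ _ a≡b _ = a≡b
    ... | tri> _ _ b<a = ⊥-elim (ℕₚ.<-irrefl (sym e) (mono b∈w a∈w b<a))

  Admissible-cong : ∀ {ψ w} → (∀ {a} → a ∈ w → φ a ≡ ψ a) → Admissible r φ w → Admissible r ψ w
  Admissible-cong φ≗ψ A = record
    { injective = λ a∈w b∈w e → injective A a∈w b∈w (trans (φ≗ψ a∈w) (trans e (sym (φ≗ψ b∈w))))
    ; monotone = λ a∈w b∈w ra rb a<b → subst₂ _<_ (φ≗ψ a∈w) (φ≗ψ b∈w) (monotone A a∈w b∈w ra rb a<b)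
    }

  Admissible-resp-↭ : ∀ {xs ys} → xs ↭ ys → Admissible r φ ys → Admissible r φ xs
  Admissible-resp-↭ xs↭ys A = record
    { injective = λ a∈ b∈ → injective A (↭ₚ.∈-resp-↭ xs↭ys a∈) (↭ₚ.∈-resp-↭ xs↭ys b∈)
    ; monotone = λ a∈ b∈ ra rb → monotone A (↭ₚ.∈-resp-↭ xs↭ys a∈) (↭ₚ.∈-resp-↭ xs↭ys b∈)
                   (subst (r ≤_) (countᵇ-↭ _ xs↭ys) ra) (subst (r ≤_) (countᵇ-↭ _ xs↭ys) rb)
    }

  Admissible-++⁻ˡ : ∀ xs ys → Admissible r φ (xs ++ ys) → Admissible r φ xs
  Admissible-++⁻ˡ xs ys A = record
    { injective = λ a∈ b∈ → injective A (∈ₚ.∈-++⁺ˡ a∈) (∈ₚ.∈-++⁺ˡ b∈)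
    ; monotone = λ a∈ b∈ ra rb → monotone A (∈ₚ.∈-++⁺ˡ a∈) (∈ₚ.∈-++⁺ˡ b∈) (more ra) (more rb)
    }
    where
    more : ∀ {a} → r ≤ occurrences xs a → r ≤ occurrences (xs ++ ys) a
    more le = ℕₚ.≤-trans le (subst (_ ≤_) (sym (countᵇ-++ _ xs ys)) (ℕₚ.m≤m+n _ _))

  Admissible-++⁻ʳ : ∀ xs ys → Admissible r φ (xs ++ ys) → Admissible r φ ys
  Admissible-++⁻ʳ xs ys A = record
    { injective = λ a∈ b∈ → injective A (∈ₚ.∈-++⁺ʳ xs a∈) (∈ₚ.∈-++⁺ʳ xs b∈)
    ; monotone = λ a∈ b∈ ra rb → monotone A (∈ₚ.∈-++⁺ʳ xs a∈) (∈ₚ.∈-++⁺ʳ xs b∈) (more ra) (more rb)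
    }
    where
    more : ∀ {a} → r ≤ occurrences ys a → r ≤ occurrences (xs ++ ys) a
    more le = ℕₚ.≤-trans le (subst (_ ≤_) (sym (countᵇ-++ _ xs ys)) (ℕₚ.m≤n+m _ _))

  Admissible-take : ∀ i w → Admissible r φ w → Admissible r φ (take i w)
  Admissible-take i w A = Admissible-++⁻ˡ (take i w) (drop i w) (subst (Admissible r φ) (sym (Listₚ.take++drop≡id i w)) A)

  Admissible-drop : ∀ i w → Admissible r φ w → Admissible r φ (drop i w)
  Admissible-drop i w A = Admissible-++⁻ʳ (take i w) (drop i w) (subst (Admissible r φ) (sym (Listₚ.take++drop≡id i w)) A)

  Admissible-++⁺ : ∀ xs ys → Admissible r φ xs → Admissible r φ ys →
    (∀ {a b} → a ∈ xs → b ∈ ys → a < b) → (∀ {a b} → a ∈ xs → b ∈ ys → φ a < φ b) → Admissible r φ (xs ++ ys)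
  Admissible-++⁺ xs ys Ax Ay sep φ-sep = record { injective = inj ; monotone = mono }
    where
    occurrences-++ˡ : ∀ {a} → a ∈ xs → occurrences (xs ++ ys) a ≡ occurrences xs a
    occurrences-++ˡ {a} a∈ = trans (countᵇ-++ _ xs ys)
      (trans (cong (occurrences xs a +_) (countᵇ-none ys (λ {b} b∈ → dec-false (b ≟ a) (λ { refl → ℕₚ.<-irrefl refl (sep a∈ b∈) }))))
             (ℕₚ.+-identityʳ _))
    occurrences-++ʳ : ∀ {a} → a ∈ ys → occurrences (xs ++ ys) a ≡ occurrences ys a
    occurrences-++ʳ {a} a∈ = trans (countᵇ-++ _ xs ys)
      (cong (_+ occurrences ys a) (countᵇ-none xs (λ {b} b∈ → dec-false (b ≟ a) (λ { refl → ℕₚ.<-irrefl refl (sep b∈ a∈) }))))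
    inj : ∀ {a b} → a ∈ xs ++ ys → b ∈ xs ++ ys → φ a ≡ φ b → a ≡ b
    inj a∈ b∈ e with ∈ₚ.∈-++⁻ xs a∈ | ∈ₚ.∈-++⁻ xs b∈
    ... | inj₁ a∈xs | inj₁ b∈xs = injective Ax a∈xs b∈xs e
    ... | inj₁ a∈xs | inj₂ b∈ys = ⊥-elim (ℕₚ.<-irrefl e (φ-sep a∈xs b∈ys))
    ... | inj₂ a∈ys | inj₁ b∈xs = ⊥-elim (ℕₚ.<-irrefl (sym e) (φ-sep b∈xs a∈ys))
    ... | inj₂ a∈ys | inj₂ b∈ys = injective Ay a∈ys b∈ys e
    mono : ∀ {a b} → a ∈ xs ++ ys → b ∈ xs ++ ys →
      r ≤ occurrences (xs ++ ys) a → r ≤ occurrences (xs ++ ys) b → a < b → φ a < φ b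
    mono a∈ b∈ ra rb a<b with ∈ₚ.∈-++⁻ xs a∈ | ∈ₚ.∈-++⁻ xs b∈
    ... | inj₁ a∈xs | inj₁ b∈xs =
      monotone Ax a∈xs b∈xs (subst (r ≤_) (occurrences-++ˡ a∈xs) ra) (subst (r ≤_) (occurrences-++ˡ b∈xs) rb) a<b
    ... | inj₁ a∈xs | inj₂ b∈ys = φ-sep a∈xs b∈ys
    ... | inj₂ a∈ys | inj₁ b∈xs = ⊥-elim (ℕₚ.<-asym a<b (sep b∈xs a∈ys))
    ... | inj₂ a∈ys | inj₂ b∈ys =
      monotone Ay a∈ys b∈ys (subst (r ≤_) (occurrences-++ʳ a∈ys) ra) (subst (r ≤_) (occurrences-++ʳ b∈ys) rb) a<b

Admissible-≟ : ∀ {r φ w} → Admissible r φ w → ∀ {a b} → a ∈ w → b ∈ w → does (a ≟ b) ≡ does (φ a ≟ φ b)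
Admissible-≟ {φ = φ} A {a} {b} a∈ b∈ = does-⇔ (mk⇔ (cong φ) (injective A a∈ b∈)) (a ≟ b) (φ a ≟ φ b)

Admissible-< : ∀ {r φ w} → Admissible r φ w → ∀ {a b} → a ∈ w → b ∈ w → r ≤ occurrences w a → r ≤ occurrences w b →
  does (suc a ≤? b) ≡ does (suc (φ a) ≤? φ b)
Admissible-< {φ = φ} A {a} {b} a∈ b∈ ra rb = does-⇔ (mk⇔ (monotone A a∈ b∈ ra rb) reflect) (suc a ≤? b) (suc (φ a) ≤? φ b)
  where
  reflect : φ a < φ b → a < b
  reflect φa<φb with ℕₚ.<-cmp a b
  ... | tri< a<b _ _ = a<b
  ... | tri≈ _ refl _ = ⊥-elim (ℕₚ.<-irrefl refl φa<φb)
  ... | tri> _ _ b<a = ⊥-elim (ℕₚ.<-asym φa<φb (monotone A b∈ a∈ rb ra b<a))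

RelabellingInvariant : ℕ → Series → Set
RelabellingInvariant r f = ∀ φ w → Admissible r φ w → f (map φ w) ≡ f w

VanishesAbove : ℕ → Series → Set
VanishesAbove D f = ∀ w → D < length w → f w ≡ 0ℚ

letterAt : ∀ {n} (w : List ℕ) → length w ≡ n → Fin n → ℕ
letterAt w p j = lookup w (Fin.cast (sym p) j)

letterAt-∈ : ∀ {n} w (p : length w ≡ n) j → letterAt w p j ∈ w
letterAt-∈ w p j = ∈ₚ.∈-lookup (Fin.cast (sym p) j)

lookup-map-toℕ : ∀ {A B : Set} (f : A → B) xs (i : Fin (length (map f xs))) (k : Fin (length xs)) →
  Fin.toℕ i ≡ Fin.toℕ k → lookup (map f xs) i ≡ f (lookup xs k)
lookup-map-toℕ f (x ∷ xs) Fin.zero Fin.zero _ = refl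
lookup-map-toℕ f (x ∷ xs) (Fin.suc i) (Fin.suc k) e = lookup-map-toℕ f xs i k (ℕₚ.suc-injective e)

letterAt-map : ∀ {n} (φ : ℕ → ℕ) w (p′ : length (map φ w) ≡ n) (p : length w ≡ n) j →
  letterAt (map φ w) p′ j ≡ φ (letterAt w p j)
letterAt-map φ w p′ p j = lookup-map-toℕ φ w _ _ (trans (Finₚ.toℕ-cast (sym p′) j) (sym (Finₚ.toℕ-cast (sym p) j)))

countᵇ-letterAt : ∀ {n} (q : ℕ → Bool) w (p : length w ≡ n) → countᵇ q w ≡ countᵇ (q ∘ letterAt w p) (allFin n)
countᵇ-letterAt q w refl = begin
    countᵇ q w
  ≡⟨ cong (countᵇ q) (sym (Listₚ.tabulate-lookup w)) ⟩
    countᵇ q (tabulate (lookup w))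
  ≡⟨ cong (countᵇ q) (Listₚ.tabulate-cong (λ i → cong (lookup w) (sym (Finₚ.cast-is-id refl i)))) ⟩
    countᵇ q (tabulate (letterAt w refl))
  ≡⟨ cong (countᵇ q) (sym (Listₚ.map-tabulate id (letterAt w refl))) ⟩
    countᵇ q (map (letterAt w refl) (allFin (length w)))
  ≡⟨ countᵇ-map q (letterAt w refl) (allFin (length w)) ⟩
    countᵇ (q ∘ letterAt w refl) (allFin (length w)) ∎
  where open ≡-Reasoning

eqOKᵇ-cong : ∀ {n} (V V′ : Fin n → ℕ) bs →
  (∀ j k → does (V j ≟ V k) ≡ does (V′ j ≟ V′ k)) → eqOKᵇ V bs ≡ eqOKᵇ V′ bs
eqOKᵇ-cong {n} V V′ bs h =
  allᵇ-cong (allFin n) (λ {j} _ → allᵇ-cong (allFin n) (λ {k} _ → cong (_==ᵇ sameBlockᵇ V bs j k) (h j k)))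

eqOKᵇ-≡true⁻ : ∀ {n} (V : Fin n → ℕ) bs → eqOKᵇ V bs ≡ true → ∀ j k → does (V j ≟ V k) ≡ sameBlockᵇ V bs j k
eqOKᵇ-≡true⁻ V bs e j k = ==ᵇ-≡true⁻ (allᵇ-≡true⁻ (allᵇ-≡true⁻ e (∈ₚ.∈-allFin j)) (∈ₚ.∈-allFin k))

ordOKᵇ-cong : ∀ {n} (V V′ : Fin n → ℕ) Φ →
  (∀ {j k} → j ∈ concat Φ → k ∈ concat Φ → does (suc (V j) ≤? V k) ≡ does (suc (V′ j) ≤? V′ k)) →
  ordOKᵇ V Φ ≡ ordOKᵇ V′ Φ
ordOKᵇ-cong V V′ [] h = refl
ordOKᵇ-cong V V′ (b ∷ bs) h = cong₂ _∧_
  (allᵇ-cong b (λ j∈b → allᵇ-cong bs (λ c∈bs → allᵇ-cong _ (λ k∈c →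
     h (∈ₚ.∈-++⁺ˡ j∈b) (∈ₚ.∈-++⁺ʳ b (∈ₚ.∈-concat⁺′ k∈c c∈bs))))))
  (ordOKᵇ-cong V V′ bs (λ j∈ k∈ → h (∈ₚ.∈-++⁺ʳ b j∈) (∈ₚ.∈-++⁺ʳ b k∈)))

ordOKᵇ-≡true⁻ : ∀ {n} (V : Fin n → ℕ) Φ → ordOKᵇ V Φ ≡ true →
  ∀ {b c j k} → Before b c Φ → j ∈ b → k ∈ c → V j < V k
ordOKᵇ-≡true⁻ V (b ∷ bs) e (here c∈bs) j∈b k∈c =
  does≡true⇒ (suc (V _) ≤? V _) (allᵇ-≡true⁻ (allᵇ-≡true⁻ (allᵇ-≡true⁻ (proj₁ (∧-≡true⁻ e)) j∈b) c∈bs) k∈c)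
ordOKᵇ-≡true⁻ V (b ∷ bs) e (there bf) j∈b k∈c = ordOKᵇ-≡true⁻ V bs (proj₂ (∧-≡true⁻ {allᵇ _ b} e)) bf j∈b k∈c

ordOKᵇ-≡true⁺ : ∀ {n} (V : Fin n → ℕ) Φ →
  (∀ {b c j k} → Before b c Φ → j ∈ b → k ∈ c → V j < V k) → ordOKᵇ V Φ ≡ true
ordOKᵇ-≡true⁺ V [] h = refl
ordOKᵇ-≡true⁺ V (b ∷ bs) h = ∧-≡true⁺
  (allᵇ-≡true⁺ b (λ j∈b → allᵇ-≡true⁺ bs (λ c∈bs → allᵇ-≡true⁺ _ (λ k∈c →
     dec-true (suc (V _) ≤? V _) (h (here c∈bs) j∈b k∈c)))))
  (ordOKᵇ-≡true⁺ V bs (λ bf → h (there bf)))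

monomialᵇ : ∀ {r n} → RSetComp r n → (w : List ℕ) → Dec (length w ≡ n) → Bool
monomialᵇ σ w (yes p) = isMonomialOfᵇ (letterAt w p) σ
monomialᵇ σ w (no _) = false

indicator : Bool → ℚ
indicator b = if b then 1ℚ else 0ℚ

M≡indicator : ∀ {r n} (σ : RSetComp r n) w → M σ w ≡ indicator (monomialᵇ σ w (length w ≟ n))
M≡indicator {n = n} σ w with length w ≟ n
... | yes _ = refl
... | no _ = refl

M-0⊎1 : ∀ {r n} (σ : RSetComp r n) w → M σ w ≡ 0ℚ ⊎ M σ w ≡ 1ℚ
M-0⊎1 {n = n} σ w with monomialᵇ σ w (length w ≟ n) | M≡indicator σ w
... | true | e = inj₂ e
... | false | e = inj₁ e

M-nonneg : ∀ {r n} (σ : RSetComp r n) w → 0ℚ ℚ.≤ M σ w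
M-nonneg σ w with M-0⊎1 σ w
... | inj₁ e = subst (0ℚ ℚ.≤_) (sym e) ℚₚ.≤-refl
... | inj₂ e = subst (0ℚ ℚ.≤_) (sym e) (ℚₚ.nonNegative⁻¹ 1ℚ)

M-length : ∀ {r n} (σ : RSetComp r n) w → length w ≢ n → M σ w ≡ 0ℚ
M-length {n = n} σ w ≢n = trans (M≡indicator σ w) (cong indicator (monomialᵇ-no (length w ≟ n)))
  where
  monomialᵇ-no : ∀ d → monomialᵇ σ w d ≡ false
  monomialᵇ-no (yes p) = ⊥-elim (≢n p)
  monomialᵇ-no (no _) = refl

Φ-letters-dominant : ∀ {r n} (σ : RSetComp r n) w (p : length w ≡ n) →
  eqOKᵇ (letterAt w p) (RSetComp.Φ σ ++ RSetComp.Π σ) ≡ true →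
  ∀ {j} → j ∈ concat (RSetComp.Φ σ) → r ≤ occurrences w (letterAt w p j)
Φ-letters-dominant {r} {n} σ w p e {j} j∈Φ = begin
    r                                  ≤⟨ All.lookup Φ-large b∈Φ ⟩
    length b                           ≡⟨ sym (countᵇ-all b sameLetter) ⟩
    countᵇ q b                         ≤⟨ countᵇ-concat q (∈ₚ.∈-++⁺ˡ b∈Φ) ⟩
    countᵇ q (concat (Φ ++ Π))         ≡⟨ countᵇ-↭ q covers ⟩
    countᵇ q (allFin _)                ≡⟨ sym (countᵇ-letterAt (λ z → does (z ≟ V j)) w p) ⟩
    occurrences w (V j)                ∎
  where
  open RSetComp σ
  open ℕₚ.≤-Reasoning
  V : Fin n → ℕ
  V = letterAt w p
  q : Fin n → Bool
  q i = does (V i ≟ V j)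
  b : List (Fin n)
  b = proj₁ (∈ₚ.∈-concat⁻′ Φ j∈Φ)
  j∈b : j ∈ b
  j∈b = proj₁ (proj₂ (∈ₚ.∈-concat⁻′ Φ j∈Φ))
  b∈Φ : b ∈ Φ
  b∈Φ = proj₂ (proj₂ (∈ₚ.∈-concat⁻′ Φ j∈Φ))
  sameLetter : ∀ {k} → k ∈ b → q k ≡ true
  sameLetter k∈b = trans (eqOKᵇ-≡true⁻ V (Φ ++ Π) e _ j)
                         (anyᵇ-≡true⁺ (∈ₚ.∈-++⁺ˡ b∈Φ) (∧-≡true⁺ (∈⇒∈ᵇ k∈b) (∈⇒∈ᵇ j∈b)))

isMonomialOfᵇ-map : ∀ {r n} (σ : RSetComp r n) φ w → Admissible r φ w →
  (p′ : length (map φ w) ≡ n) (p : length w ≡ n) → isMonomialOfᵇ (letterAt (map φ w) p′) σ ≡ isMonomialOfᵇ (letterAt w p) σ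
isMonomialOfᵇ-map {n = n} σ φ w A p′ p = ∧-cong-guarded (sym sameEq) λ e → sym (ordOKᵇ-cong V V′ Φ (λ {j} {k} j∈ k∈ →
    trans (Admissible-< A (letterAt-∈ w p j) (letterAt-∈ w p k) (Φ-letters-dominant σ w p e j∈) (Φ-letters-dominant σ w p e k∈))
          (cong₂ (λ x y → does (suc x ≤? y)) (sym (letterAt-map φ w p′ p j)) (sym (letterAt-map φ w p′ p k)))))
  where
  open RSetComp σ
  V V′ : Fin n → ℕ
  V = letterAt w p
  V′ = letterAt (map φ w) p′
  sameEq : eqOKᵇ V (Φ ++ Π) ≡ eqOKᵇ V′ (Φ ++ Π)
  sameEq = eqOKᵇ-cong V V′ (Φ ++ Π) λ j k →
    trans (Admissible-≟ A (letterAt-∈ w p j) (letterAt-∈ w p k))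
          (cong₂ (λ x y → does (x ≟ y)) (sym (letterAt-map φ w p′ p j)) (sym (letterAt-map φ w p′ p k)))

M-invariant : ∀ {r n} (σ : RSetComp r n) → RelabellingInvariant r (M σ)
M-invariant {n = n} σ φ w A = begin
    M σ (map φ w)                                          ≡⟨ M≡indicator σ (map φ w) ⟩
    indicator (monomialᵇ σ (map φ w) (length (map φ w) ≟ n)) ≡⟨ cong indicator (same (length (map φ w) ≟ n) (length w ≟ n)) ⟩
    indicator (monomialᵇ σ w (length w ≟ n))                 ≡⟨ sym (M≡indicator σ w) ⟩
    M σ w                                                    ∎
  where
  open ≡-Reasoning
  same : ∀ d′ d → monomialᵇ σ (map φ w) d′ ≡ monomialᵇ σ w d
  same (yes p′) (yes p) = isMonomialOfᵇ-map σ φ w A p′ p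
  same (yes p′) (no ¬p) = ⊥-elim (¬p (trans (sym (Listₚ.length-map φ w)) p′))
  same (no ¬p′) (yes p) = ⊥-elim (¬p′ (trans (Listₚ.length-map φ w) p))
  same (no _) (no _) = refl

InNCQSymʳ⇒invariant : ∀ {r f} → InNCQSymʳ r f → RelabellingInvariant r f
InNCQSymʳ⇒invariant (ts , f≡) φ w A =
  trans (f≡ (map φ w))
    (trans (sumℚ-map-cong ts (λ { {(_ , σ) , c} _ → cong (c ℚ.*_) (M-invariant σ φ w A) }))
           (sym (f≡ w)))

degreeBound : ∀ {r} → List (RTerm r × ℚ) → ℕ
degreeBound [] = 0
degreeBound (((n , _) , _) ∷ ts) = n ⊔ degreeBound ts

degreeBound-≥ : ∀ {r} {ts : List (RTerm r × ℚ)} {n σ c} → ((n , σ) , c) ∈ ts → n ≤ degreeBound ts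
degreeBound-≥ {ts = ((n , _) , _) ∷ ts} (here refl) = ℕₚ.m≤m⊔n n (degreeBound ts)
degreeBound-≥ {ts = ((n , _) , _) ∷ ts} (there m) = ℕₚ.≤-trans (degreeBound-≥ m) (ℕₚ.m≤n⊔m n (degreeBound ts))

InNCQSymʳ⇒vanishesAbove : ∀ {r f} → (f∈ : InNCQSymʳ r f) → VanishesAbove (degreeBound (proj₁ f∈)) f
InNCQSymʳ⇒vanishesAbove (ts , f≡) w D<|w| = trans (f≡ w) (sumℚ-map-zero ts λ { {(n , σ) , c} t∈ts →
  trans (cong (c ℚ.*_) (M-length σ w (λ { refl → ℕₚ.<-irrefl refl (ℕₚ.≤-<-trans (degreeBound-≥ t∈ts) D<|w|) })))
        (ℚₚ.*-zeroʳ c) })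

-- The canonical r-set-composition of a word

nonempty⇒1≤length : ∀ {A : Set} (b : List A) → not (null b) ≡ true → 1 ≤ length b
nonempty⇒1≤length (_ ∷ _) _ = s≤s z≤n

∈⇒nonempty : ∀ {A : Set} {x : A} {b} → x ∈ b → not (null b) ≡ true
∈⇒nonempty (here _) = refl
∈⇒nonempty (there _) = refl

indicator-≡1⁻ : ∀ {b} → indicator b ≡ 1ℚ → b ≡ true
indicator-≡1⁻ {true} _ = refl
indicator-≡1⁻ {false} e = ⊥-elim (ℚₚ.1≢0 (sym e))

tabulate-letterAt : ∀ {n} w (p : length w ≡ n) → tabulate (letterAt w p) ≡ w
tabulate-letterAt w refl = trans (Listₚ.tabulate-cong (λ i → cong (lookup w) (Finₚ.cast-is-id refl i))) (Listₚ.tabulate-lookup w)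

module Canonical (r : ℕ) (z : List ℕ) where

  letter : Fin (length z) → ℕ
  letter = lookup z

  bound : ℕ
  bound = suc (maxℕ z)

  letter<bound : ∀ i → letter i < bound
  letter<bound i = s≤s (maxℕ-≥ (∈ₚ.∈-lookup {xs = z} i))

  positionsOf : ℕ → List (Fin (length z))
  positionsOf v = filterᵇ (λ i → does (letter i ≟ v)) (allFin (length z))

  groups : List (List (Fin (length z)))
  groups = filterᵇ (not ∘ null) (map positionsOf (upTo bound))

  large : List (Fin (length z)) → Bool
  large b = does (r ≤? length b)

  Φᶜ Πᶜ : List (List (Fin (length z)))
  Φᶜ = filterᵇ large groups
  Πᶜ = filterᵇ (not ∘ large) groups

  covers : concat (Φᶜ ++ Πᶜ) ↭ allFin (length z)
  covers = begin
      concat (Φᶜ ++ Πᶜ)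
    ≡⟨ sym (Listₚ.concat-++ Φᶜ Πᶜ) ⟩
      concat Φᶜ ++ concat Πᶜ
    ↭⟨ concat-partition large groups ⟩
      concat groups
    ≡⟨ concat-filterᵇ-nonempty (map positionsOf (upTo bound)) ⟩
      concat (map positionsOf (upTo bound))
    ↭⟨ group-by-key letter (allFin (length z)) bound ⟩
      filterᵇ (λ i → does (letter i <? bound)) (allFin (length z))
    ≡⟨ filterᵇ-all _ (λ {i} _ → dec-true (letter i <? bound) (letter<bound i)) ⟩
      allFin (length z) ∎
    where open PermutationReasoning

  σ : RSetComp r (length z)
  σ = record
    { Φ = Φᶜ
    ; Π = Πᶜ
    ; covers = covers
    ; Φ-large = All-filterᵇ groups (λ {b} _ → does≡true⇒ (r ≤? length b))
    ; Π-nonempty = All-filterᵇ groups (λ {b} b∈ _ →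
        nonempty⇒1≤length b (proj₂ (∈-filterᵇ⁻ {p = not ∘ null} (map positionsOf (upTo bound)) b∈)))
    ; Π-small = All-filterᵇ groups (λ {b} _ e → ℕₚ.≰⇒> (does≡false⇒ (r ≤? length b) (not-≡true⁻ e)))
    }

  ∈-positionsOf : ∀ j → j ∈ positionsOf (letter j)
  ∈-positionsOf j = ∈-filterᵇ⁺ (∈ₚ.∈-allFin j) (≟-refl (letter j))

  ∈ᵇ-positionsOf : ∀ i v → (i ∈ᵇ positionsOf v) ≡ does (letter i ≟ v)
  ∈ᵇ-positionsOf i v = trans (∈ᵇ≡does-any? i (positionsOf v)) (does-⇔
    (mk⇔ (λ i∈ → ≟-≡true⁻ (proj₂ (∈-filterᵇ⁻ (allFin _) i∈))) (λ e → ∈-filterᵇ⁺ (∈ₚ.∈-allFin i) (dec-true (letter i ≟ v) e)))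
    (any? (i Fin.≟_) (positionsOf v)) (letter i ≟ v))

  occurrences-letter : ∀ v → occurrences z v ≡ length (positionsOf v)
  occurrences-letter v = trans (countᵇ-letterAt _ z refl)
    (countᵇ-cong (allFin _) (λ {j} _ → cong (λ y → does (y ≟ v)) (cong (lookup z) (Finₚ.cast-is-id refl j))))

  common-value : ∀ a b → a < bound → anyᵇ (λ v → does (a ≟ v) ∧ does (b ≟ v)) (upTo bound) ≡ does (a ≟ b)
  common-value a b a<bound = helper (a ≟ b)
    where
    helper : (d : Dec (a ≡ b)) → anyᵇ (λ v → does (a ≟ v) ∧ does (b ≟ v)) (upTo bound) ≡ does d
    helper (yes refl) = anyᵇ-≡true⁺ (∈ₚ.∈-upTo⁺ a<bound) (∧-≡true⁺ (≟-refl a) (≟-refl a))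
    helper (no a≢b) = anyᵇ-≡false⁺ (upTo bound) (λ {v} _ → ∧-≡false⁺ (λ a≡v b≡v → a≢b (trans (≟-≡true⁻ a≡v) (sym (≟-≡true⁻ b≡v)))))

  sameBlockᵇ-σ : ∀ (V : Fin (length z) → ℕ) j k → sameBlockᵇ V (Φᶜ ++ Πᶜ) j k ≡ does (letter j ≟ letter k)
  sameBlockᵇ-σ V j k = begin
      anyᵇ P (Φᶜ ++ Πᶜ)
    ≡⟨ anyᵇ-++ P Φᶜ Πᶜ ⟩
      anyᵇ P Φᶜ ∨ anyᵇ P Πᶜ
    ≡⟨ anyᵇ-partition P large groups ⟩
      anyᵇ P groups
    ≡⟨ anyᵇ-filterᵇ P (not ∘ null) (map positionsOf (upTo bound)) (λ { [] _ → refl }) ⟩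
      anyᵇ P (map positionsOf (upTo bound))
    ≡⟨ anyᵇ-map P positionsOf (upTo bound) ⟩
      anyᵇ (P ∘ positionsOf) (upTo bound)
    ≡⟨ anyᵇ-cong (upTo bound) (λ {v} _ → cong₂ _∧_ (∈ᵇ-positionsOf j v) (∈ᵇ-positionsOf k v)) ⟩
      anyᵇ (λ v → does (letter j ≟ v) ∧ does (letter k ≟ v)) (upTo bound)
    ≡⟨ common-value (letter j) (letter k) (letter<bound j) ⟩
      does (letter j ≟ letter k) ∎
    where
    open ≡-Reasoning
    P : List (Fin (length z)) → Bool
    P b = (j ∈ᵇ b) ∧ (k ∈ᵇ b)

  ordOKᵇ⇒monotone : ∀ (V : Fin (length z) → ℕ) → ordOKᵇ V Φᶜ ≡ true → ∀ j k →
    r ≤ length (positionsOf (letter j)) → r ≤ length (positionsOf (letter k)) → letter j < letter k → V j < V k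
  ordOKᵇ⇒monotone V e j k rj rk j<k = ordOKᵇ-≡true⁻ V Φᶜ e inΦᶜ (∈-positionsOf j) (∈-positionsOf k)
    where
    inUpTo : Before (letter j) (letter k) (upTo bound)
    inUpTo = Before-applyUpTo⁺ id j<k (letter<bound k)
    inGroups : Before (positionsOf (letter j)) (positionsOf (letter k)) groups
    inGroups = Before-filterᵇ⁺ {p = not ∘ null} (Before-map⁺ positionsOf inUpTo)
                 (∈⇒nonempty (∈-positionsOf j)) (∈⇒nonempty (∈-positionsOf k))
    inΦᶜ : Before (positionsOf (letter j)) (positionsOf (letter k)) Φᶜ
    inΦᶜ = Before-filterᵇ⁺ {p = large} inGroups (dec-true (r ≤? _) rj) (dec-true (r ≤? _) rk)

  ordOKᵇ-letter : ordOKᵇ letter Φᶜ ≡ true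
  ordOKᵇ-letter = ordOKᵇ-≡true⁺ letter Φᶜ ordered
    where
    ordered : ∀ {b c j k} → Before b c Φᶜ → j ∈ b → k ∈ c → letter j < letter k
    ordered bf j∈ k∈
      with Before-map⁻ positionsOf (upTo bound) (Before-filterᵇ⁻ {p = not ∘ null} _ (Before-filterᵇ⁻ {p = large} groups bf))
    ... | v , v′ , refl , refl , bf′ =
      subst₂ _<_ (sym (≟-≡true⁻ (proj₂ (∈-filterᵇ⁻ (allFin _) j∈)))) (sym (≟-≡true⁻ (proj₂ (∈-filterᵇ⁻ (allFin _) k∈))))
        (Before-upTo⁻ bound bf′)

  eqOKᵇ-letter : eqOKᵇ letter (Φᶜ ++ Πᶜ) ≡ true
  eqOKᵇ-letter = allᵇ-≡true⁺ (allFin _) (λ {j} _ → allᵇ-≡true⁺ (allFin _) (λ {k} _ →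
    subst (λ b → (does (letter j ≟ letter k) ==ᵇ b) ≡ true) (sym (sameBlockᵇ-σ letter j k)) (==ᵇ-refl (does (letter j ≟ letter k)))))

  letterAt-self : ∀ (p : length z ≡ length z) j → letterAt z p j ≡ letter j
  letterAt-self p j = cong (lookup z) (Finₚ.cast-is-id (sym p) j)

  M-self : M σ z ≡ 1ℚ
  M-self = trans (M≡indicator σ z) (cong indicator (monomial (length z ≟ length z)))
    where
    monomial : ∀ d → monomialᵇ σ z d ≡ true
    monomial (yes p) = ∧-≡true⁺
      (trans (eqOKᵇ-cong (letterAt z p) letter (Φᶜ ++ Πᶜ) (λ j k → cong₂ (λ x y → does (x ≟ y)) (letterAt-self p j) (letterAt-self p k)))
             eqOKᵇ-letter)
      (trans (ordOKᵇ-cong (letterAt z p) letter Φᶜ (λ {j} {k} _ _ → cong₂ (λ x y → does (suc x ≤? y)) (letterAt-self p j) (letterAt-self p k)))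
             ordOKᵇ-letter)
    monomial (no ¬p) = ⊥-elim (¬p refl)

  monomial⇒relabelling : ∀ w (p : length w ≡ length z) → isMonomialOfᵇ (letterAt w p) σ ≡ true →
    ∃ λ φ → Admissible r φ z × map φ z ≡ w
  monomial⇒relabelling w p e = φ , admissible , map-φ
    where
    V : Fin (length z) → ℕ
    V = letterAt w p
    eqOK : eqOKᵇ V (Φᶜ ++ Πᶜ) ≡ true
    eqOK = proj₁ (∧-≡true⁻ {eqOKᵇ V (Φᶜ ++ Πᶜ)} e)
    ordOK : ordOKᵇ V Φᶜ ≡ true
    ordOK = proj₂ (∧-≡true⁻ {eqOKᵇ V (Φᶜ ++ Πᶜ)} e)

    same-pattern : ∀ j k → does (V j ≟ V k) ≡ does (letter j ≟ letter k)
    same-pattern j k = trans (eqOKᵇ-≡true⁻ V (Φᶜ ++ Πᶜ) eqOK j k) (sameBlockᵇ-σ V j k)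

    -- φ a is the letter of w at some position where z carries a; by the
    -- pattern equality above it does not matter which one.
    pick : ∀ a → Dec (∃ λ j → letter j ≡ a) → ℕ
    pick a (yes (j , _)) = V j
    pick a (no _) = 0

    φ : ℕ → ℕ
    φ a = pick a (Finₚ.any? (λ j → letter j ≟ a))

    φ-letter : ∀ i → φ (letter i) ≡ V i
    φ-letter i = pick-letter (Finₚ.any? (λ j → letter j ≟ letter i))
      where
      pick-letter : ∀ d → pick (letter i) d ≡ V i
      pick-letter (yes (j , e)) = ≟-≡true⁻ (trans (same-pattern j i) (dec-true (letter j ≟ letter i) e))
      pick-letter (no ¬e) = ⊥-elim (¬e (i , refl))

    map-φ : map φ z ≡ w
    map-φ = begin
      map φ z                 ≡⟨ cong (map φ) (sym (Listₚ.tabulate-lookup z)) ⟩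
      map φ (tabulate letter) ≡⟨ Listₚ.map-tabulate letter φ ⟩
      tabulate (φ ∘ letter)   ≡⟨ Listₚ.tabulate-cong φ-letter ⟩
      tabulate V              ≡⟨ tabulate-letterAt w p ⟩
      w                       ∎
      where open ≡-Reasoning

    position : ∀ {a} → a ∈ z → ∃ λ i → a ≡ letter i
    position a∈z = Any.index a∈z , lookup-index a∈z

    admissible : Admissible r φ z
    injective admissible a∈ b∈ φa≡φb with position a∈ | position b∈
    ... | i , refl | k , refl =
      ≟-≡true⁻ (trans (sym (same-pattern i k)) (dec-true (V i ≟ V k) (trans (sym (φ-letter i)) (trans φa≡φb (φ-letter k)))))
    monotone admissible a∈ b∈ ra rb a<b with position a∈ | position b∈
    ... | i , refl | k , refl = subst₂ _<_ (sym (φ-letter i)) (sym (φ-letter k))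
      (ordOKᵇ⇒monotone V ordOK i k (subst (r ≤_) (occurrences-letter (letter i)) ra) (subst (r ≤_) (occurrences-letter (letter k)) rb) a<b)

  M≡1⇒relabelling : ∀ w → M σ w ≡ 1ℚ → ∃ λ φ → Admissible r φ z × map φ z ≡ w
  M≡1⇒relabelling w M≡1 = from-monomial (length w ≟ length z) (indicator-≡1⁻ (trans (sym (M≡indicator σ w)) M≡1))
    where
    from-monomial : ∀ d → monomialᵇ σ w d ≡ true → ∃ λ φ → Admissible r φ z × map φ z ≡ w
    from-monomial (yes p) = monomial⇒relabelling w p

-- Invariant series of bounded degree lie in NCQSym^r

words : ℕ → ℕ → List (List ℕ)
words zero B = [] ∷ []
words (suc n) B = concat (map (λ a → map (a ∷_) (words n B)) (upTo B))

∈-words : ∀ {B} z → All (_< B) z → z ∈ words (length z) B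
∈-words [] [] = here refl
∈-words {B} (a ∷ z) (a<B ∷ z<B) =
  ∈ₚ.∈-concat⁺′ (∈ₚ.∈-map⁺ (a ∷_) (∈-words z z<B)) (∈ₚ.∈-map⁺ (λ a → map (a ∷_) (words (length z) B)) (∈ₚ.∈-upTo⁺ a<B))

words-length : ∀ {n B z} → z ∈ words n B → length z ≡ n
words-length {zero} (here refl) = refl
words-length {suc n} {B} z∈ with ∈ₚ.∈-concat⁻′ (map (λ a → map (a ∷_) (words n B)) (upTo B)) z∈
... | _ , z∈c , c∈ with ∈ₚ.∈-map⁻ (λ a → map (a ∷_) (words n B)) c∈
...   | a , _ , refl with ∈ₚ.∈-map⁻ (a ∷_) z∈c
...     | _ , z′∈ , refl = cong suc (words-length z′∈)

rank : List ℕ → ℕ → ℕ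
rank z a = countᵇ (λ y → does (y <? a)) z

rank-strictMono : ∀ z {a b} → a ∈ z → a < b → rank z a < rank z b
rank-strictMono z {a} {b} a∈z a<b = countᵇ-mono-< z
  (λ {y} _ y<a → dec-true (y <? b) (ℕₚ.<-trans (does≡true⇒ (y <? a) y<a) a<b)) a∈z
  (dec-false (a <? a) (ℕₚ.<-irrefl refl)) (dec-true (a <? b) a<b)

rank-<-length : ∀ z {a} → a ∈ z → rank z a < length z
rank-<-length z {a} a∈z = countᵇ-< a∈z (dec-false (a <? a) (ℕₚ.<-irrefl refl))

module Spanning (r : ℕ) where

  σ : (z : List ℕ) → RSetComp r (length z)
  σ = Canonical.σ r

  matches : ℕ → List ℕ → ℚ
  matches n w = sumℚ (map (λ z → M (σ z) w) (words n n))

  normaliser : List ℕ → ℚ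
  normaliser w = matches (length w) w

  coefficient : Series → List ℕ → ℚ
  coefficient h z = h z ℚ.* inv₀ (normaliser z)

  matches-invariant : ∀ n → RelabellingInvariant r (matches n)
  matches-invariant n φ w A = sumℚ-map-cong (words n n) (λ {z} _ → M-invariant (σ z) φ w A)

  normaliser-invariant : RelabellingInvariant r normaliser
  normaliser-invariant φ w A =
    trans (cong (λ n → matches n (map φ w)) (Listₚ.length-map φ w)) (matches-invariant (length w) φ w A)

  matches-length : ∀ n w → length w ≢ n → matches n w ≡ 0ℚ
  matches-length n w ≢n = sumℚ-map-zero (words n n) (λ {z} z∈ → M-length (σ z) w (λ e → ≢n (trans e (words-length z∈))))

  -- w is a monomial of M_σ(z) for z the word of ranks of the letters of w.
  normaliser-≥1 : ∀ w → 1ℚ ℚ.≤ normaliser w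
  normaliser-≥1 w = sumℚ-map-≥1 (words (length w) (length w)) (λ {z} _ → M-nonneg (σ z) w) ranked∈ (ℚₚ.≤-reflexive (sym M-ranked))
    where
    ranked : List ℕ
    ranked = map (rank w) w
    ranked∈ : ranked ∈ words (length w) (length w)
    ranked∈ = subst (λ n → ranked ∈ words n (length w)) (Listₚ.length-map (rank w) w)
      (∈-words ranked (Allₚ.map⁺ (All.tabulate (rank-<-length w))))
    M-ranked : M (σ ranked) w ≡ 1ℚ
    M-ranked = trans (sym (M-invariant (σ ranked) (rank w) w (strictMono⇒Admissible (λ a∈ _ → rank-strictMono w a∈))))
                     (Canonical.M-self r ranked)

  normaliser-≢0 : ∀ w → normaliser w ≢ 0ℚ
  normaliser-≢0 w N≡0 = ℚₚ.<⇒≢ (ℚₚ.<-≤-trans (ℚₚ.positive⁻¹ 1ℚ) (normaliser-≥1 w)) (sym N≡0)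

  wordsBelow : ℕ → List (List ℕ)
  wordsBelow zero = []
  wordsBelow (suc K) = words K K ++ wordsBelow K

  module Expansion (h : Series) (h-invariant : RelabellingInvariant r h) (w : List ℕ) where

    term : List ℕ → ℚ
    term z = coefficient h z ℚ.* M (σ z) w

    term-matching : ∀ z → term z ≡ coefficient h w ℚ.* M (σ z) w
    term-matching z with M-0⊎1 (σ z) w
    ... | inj₁ M≡0 rewrite M≡0 = trans (ℚₚ.*-zeroʳ (coefficient h z)) (sym (ℚₚ.*-zeroʳ (coefficient h w)))
    ... | inj₂ M≡1 with Canonical.M≡1⇒relabelling r z w M≡1
    ...   | φ , A , refl = cong (ℚ._* M (σ z) (map φ z))
            (sym (cong₂ ℚ._*_ (h-invariant φ z A) (cong inv₀ (normaliser-invariant φ z A))))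

    level : ∀ n → sumℚ (map term (words n n)) ≡ coefficient h w ℚ.* matches n w
    level n = trans (sumℚ-map-cong (words n n) (λ {z} _ → term-matching z)) (sumℚ-map-*ˡ (coefficient h w) (λ z → M (σ z) w) (words n n))

    level-≢ : ∀ n → length w ≢ n → sumℚ (map term (words n n)) ≡ 0ℚ
    level-≢ n ≢n = trans (level n) (trans (cong (coefficient h w ℚ.*_) (matches-length n w ≢n)) (ℚₚ.*-zeroʳ (coefficient h w)))

    level-≡ : sumℚ (map term (words (length w) (length w))) ≡ h w
    level-≡ = begin
        sumℚ (map term (words (length w) (length w)))
      ≡⟨ level (length w) ⟩
        (h w ℚ.* inv₀ (normaliser w)) ℚ.* normaliser w
      ≡⟨ ℚₚ.*-assoc (h w) _ _ ⟩
        h w ℚ.* (inv₀ (normaliser w) ℚ.* normaliser w)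
      ≡⟨ cong (h w ℚ.*_) (inv₀-inverseˡ _ (normaliser-≢0 w)) ⟩
        h w ℚ.* 1ℚ
      ≡⟨ ℚₚ.*-identityʳ (h w) ⟩
        h w ∎
      where open ≡-Reasoning

    below-short : ∀ K → K ≤ length w → sumℚ (map term (wordsBelow K)) ≡ 0ℚ
    below-short zero _ = refl
    below-short (suc K) K<|w| = trans (sumℚ-map-++ term (words K K) (wordsBelow K))
      (cong₂ ℚ._+_ (level-≢ K (λ { refl → ℕₚ.<-irrefl refl K<|w| })) (below-short K (ℕₚ.<⇒≤ K<|w|)))

    below-long : ∀ K → length w < K → sumℚ (map term (wordsBelow K)) ≡ h w
    below-long (suc K) |w|<1+K with length w ≟ K
    ... | yes refl = trans (sumℚ-map-++ term (words K K) (wordsBelow K))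
                       (trans (cong₂ ℚ._+_ level-≡ (below-short K ℕₚ.≤-refl)) (ℚₚ.+-identityʳ (h w)))
    ... | no ≢K = trans (sumℚ-map-++ term (words K K) (wordsBelow K))
                    (trans (cong₂ ℚ._+_ (level-≢ K ≢K) (below-long K (ℕₚ.≤∧≢⇒< (ℕₚ.≤-pred |w|<1+K) ≢K))) (ℚₚ.+-identityˡ (h w)))

    expansion : ∀ D → VanishesAbove D h → h w ≡ sumℚ (map term (wordsBelow (suc D)))
    expansion D h-vanishes with length w ≤? D
    ... | yes |w|≤D = sym (below-long (suc D) (s≤s |w|≤D))
    ... | no |w|≰D = trans (h-vanishes w (ℕₚ.≰⇒> |w|≰D)) (sym (below-short (suc D) (ℕₚ.≰⇒> |w|≰D)))

  open Expansion using (expansion)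

  invariant⇒InNCQSymʳ : ∀ {h} D → RelabellingInvariant r h → VanishesAbove D h → InNCQSymʳ r h
  invariant⇒InNCQSymʳ {h} D h-invariant h-vanishes = map entry (wordsBelow (suc D)) , λ w →
    trans (expansion h h-invariant w D h-vanishes) (sym (sumℚ-map-∘ _ entry (wordsBelow (suc D))))
    where
    entry : List ℕ → RTerm r × ℚ
    entry z = (length z , σ z) , coefficient h z

  -- F is expanded in its first argument, then each coefficient F(y, ·) in its second.
  invariant²⇒InNCQSymʳ⊗NCQSymʳ : ∀ {F : Series²} D →
    (∀ v → RelabellingInvariant r (λ u → F u v)) → (∀ u → RelabellingInvariant r (F u)) →
    (∀ v → VanishesAbove D (λ u → F u v)) → (∀ u → VanishesAbove D (F u)) → InNCQSymʳ⊗NCQSymʳ r F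
  invariant²⇒InNCQSymʳ⊗NCQSymʳ {F} D invˡ invʳ vanˡ vanʳ = concat (map (λ y → map (entry y) I) I) , expand
    where
    I : List (List ℕ)
    I = wordsBelow (suc D)
    c : List ℕ → List ℕ → ℚ
    c y x = coefficient (F y) x ℚ.* inv₀ (normaliser y)
    entry : List ℕ → List ℕ → RTerm r × RTerm r × ℚ
    entry y x = (length y , σ y) , (length x , σ x) , c y x
    expand : ∀ u v → F u v ≡ _
    expand u v = begin
        F u v
      ≡⟨ expansion (λ u′ → F u′ v) (invˡ v) u D (vanˡ v) ⟩
        sumℚ (map (λ y → (F y v ℚ.* inv₀ (normaliser y)) ℚ.* M (σ y) u) I)
      ≡⟨ sumℚ-map-cong I (λ {y} _ → cong (λ t → (t ℚ.* inv₀ (normaliser y)) ℚ.* M (σ y) u) (expansion (F y) (invʳ y) v D (vanʳ y))) ⟩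
        sumℚ (map (λ y → (sumℚ (map (λ x → coefficient (F y) x ℚ.* M (σ x) v) I) ℚ.* inv₀ (normaliser y)) ℚ.* M (σ y) u) I)
      ≡⟨ sumℚ-map-cong I (λ {y} _ → sumℚ-map-*-*-rearrange (coefficient (F y)) (λ x → M (σ x) v) (inv₀ (normaliser y)) (M (σ y) u) I) ⟩
        sumℚ (map (λ y → sumℚ (map (λ x → c y x ℚ.* (M (σ y) u ℚ.* M (σ x) v)) I)) I)
      ≡⟨ sumℚ-map-cong I (λ {y} _ → sym (sumℚ-map-∘ _ (entry y) I)) ⟩
        sumℚ (map (λ y → sumℚ (map _ (map (entry y) I))) I)
      ≡⟨ sym (sumℚ-concatMap _ (λ y → map (entry y) I) I) ⟩
        _ ∎
      where
      open ≡-Reasoning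

-- Closure under the product

⋆-invariant : ∀ {r f g} → RelabellingInvariant r f → RelabellingInvariant r g → RelabellingInvariant r (f ⋆ g)
⋆-invariant {f = f} {g} f-invariant g-invariant φ w A rewrite Listₚ.length-map φ w =
  sumℚ-map-cong (upTo (suc (length w))) (λ {i} _ → cong₂ ℚ._*_
    (trans (cong f (Listₚ.take-map i w)) (f-invariant φ (take i w) (Admissible-take i w A)))
    (trans (cong g (Listₚ.drop-map i w)) (g-invariant φ (drop i w) (Admissible-drop i w A))))

⋆-vanishesAbove : ∀ {f g D E} → VanishesAbove D f → VanishesAbove E g → VanishesAbove (D + E) (f ⋆ g)
⋆-vanishesAbove {f} {g} {D} {E} f-vanishes g-vanishes w D+E<|w| = sumℚ-map-zero (upTo (suc (length w))) (λ {i} _ → factor-vanishes i)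
  where
  factor-vanishes : ∀ i → f (take i w) ℚ.* g (drop i w) ≡ 0ℚ
  factor-vanishes i with D <? length (take i w) | E <? length (drop i w)
  ... | yes D<  | _       = trans (cong (ℚ._* g (drop i w)) (f-vanishes _ D<)) (ℚₚ.*-zeroˡ (g (drop i w)))
  ... | no _    | yes E<  = trans (cong (f (take i w) ℚ.*_) (g-vanishes _ E<)) (ℚₚ.*-zeroʳ (f (take i w)))
  ... | no D≮   | no E≮   = ⊥-elim (ℕₚ.<⇒≱ D+E<|w| (begin
      length w                               ≡⟨ cong length (sym (Listₚ.take++drop≡id i w)) ⟩
      length (take i w ++ drop i w)          ≡⟨ Listₚ.length-++ (take i w) ⟩
      length (take i w) + length (drop i w)  ≤⟨ ℕₚ.+-mono-≤ (ℕₚ.≮⇒≥ D≮) (ℕₚ.≮⇒≥ E≮) ⟩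
      D + E                                  ∎))
    where open ℕₚ.≤-Reasoning

-- Closure under the coproduct

shuffles-relabel : ∀ {r f} → RelabellingInvariant r f → ∀ ψ xs ys → Admissible r ψ xs → Admissible r ψ ys →
  (∀ {a b} → a ∈ xs → b ∈ ys → a < b) → (∀ {a b} → a ∈ xs → b ∈ ys → ψ a < ψ b) →
  sumℚ (map f (shuffles (map ψ xs) (map ψ ys))) ≡ sumℚ (map f (shuffles xs ys))
shuffles-relabel {f = f} f-invariant ψ xs ys Aˣ Aʸ sep ψ-sep = begin
    sumℚ (map f (shuffles (map ψ xs) (map ψ ys)))
  ≡⟨ cong (sumℚ ∘ map f) (shuffles-map ψ xs ys) ⟩
    sumℚ (map f (map (map ψ) (shuffles xs ys)))
  ≡⟨ sumℚ-map-∘ f (map ψ) (shuffles xs ys) ⟩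
    sumℚ (map (f ∘ map ψ) (shuffles xs ys))
  ≡⟨ sumℚ-map-cong (shuffles xs ys) (λ {s} s∈ →
       f-invariant ψ s (Admissible-resp-↭ (shuffles-↭ xs ys s∈) (Admissible-++⁺ xs ys Aˣ Aʸ sep ψ-sep))) ⟩
    sumℚ (map f (shuffles xs ys)) ∎
  where open ≡-Reasoning

piecewise : ℕ → (ℕ → ℕ) → (ℕ → ℕ) → ℕ → ℕ
piecewise N low high z = if does (z <? N) then low z else high (z ∸ N)

piecewise-< : ∀ {N low high z} → z < N → piecewise N low high z ≡ low z
piecewise-< {N} {z = z} z<N rewrite dec-true (z <? N) z<N = refl

piecewise-+ : ∀ N low high y → piecewise N low high (N + y) ≡ high y
piecewise-+ N low high y
  rewrite dec-false (N + y <? N) (ℕₚ.m+n≮m N y) | ℕₚ.m+n∸m≡n N y = refl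

∈⇒<suc-maxℕ : ∀ {a u} → a ∈ u → a < suc (maxℕ u)
∈⇒<suc-maxℕ a∈u = s≤s (maxℕ-≥ a∈u)

below-shifted : ∀ u v {a b} → a ∈ u → b ∈ map (suc (maxℕ u) +_) v → a < b
below-shifted u v a∈u b∈ with ∈ₚ.∈-map⁻ (suc (maxℕ u) +_) b∈
... | y , _ , refl = ℕₚ.<-≤-trans (∈⇒<suc-maxℕ a∈u) (ℕₚ.m≤m+n _ y)

Admissible-shift : ∀ {r φ ψ v} N → Admissible r φ v → (∀ y → ψ (N + y) ≡ N + φ y) → Admissible r ψ (map (N +_) v)
Admissible-shift {r} {φ} {ψ} {v} N A ψ-shift = record { injective = inj ; monotone = mono }
  where
  occurrences-shift : ∀ y → occurrences (map (N +_) v) (N + y) ≡ occurrences v y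
  occurrences-shift y = trans (countᵇ-map _ (N +_) v)
    (countᵇ-cong v (λ {x} _ → does-⇔ (mk⇔ (ℕₚ.+-cancelˡ-≡ N x y) (cong (N +_))) (N + x ≟ N + y) (x ≟ y)))
  inj : ∀ {a b} → a ∈ map (N +_) v → b ∈ map (N +_) v → ψ a ≡ ψ b → a ≡ b
  inj a∈ b∈ ψa≡ψb with ∈ₚ.∈-map⁻ (N +_) a∈ | ∈ₚ.∈-map⁻ (N +_) b∈
  ... | x , x∈ , refl | y , y∈ , refl =
    cong (N +_) (injective A x∈ y∈ (ℕₚ.+-cancelˡ-≡ N _ _ (trans (sym (ψ-shift x)) (trans ψa≡ψb (ψ-shift y)))))
  mono : ∀ {a b} → a ∈ map (N +_) v → b ∈ map (N +_) v →
    r ≤ occurrences (map (N +_) v) a → r ≤ occurrences (map (N +_) v) b → a < b → ψ a < ψ b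
  mono a∈ b∈ ra rb a<b with ∈ₚ.∈-map⁻ (N +_) a∈ | ∈ₚ.∈-map⁻ (N +_) b∈
  ... | x , x∈ , refl | y , y∈ , refl = subst₂ _<_ (sym (ψ-shift x)) (sym (ψ-shift y))
    (ℕₚ.+-monoʳ-< N (monotone A x∈ y∈ (subst (r ≤_) (occurrences-shift x) ra) (subst (r ≤_) (occurrences-shift y) rb)
                      (ℕₚ.+-cancelˡ-< N x y a<b)))

Δ-invariantˡ : ∀ {r f} → RelabellingInvariant r f → ∀ v → RelabellingInvariant r (λ u → Δ f u v)
Δ-invariantˡ {r} {f} f-invariant v φ u A = begin
    Δ f (map φ u) v
  ≡⟨ cong₂ (λ u′ v′ → sumℚ (map f (shuffles u′ v′))) (sym (Listₚ.map-cong-local (All.tabulate ψ≗φ)))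
       (trans (Listₚ.map-cong (λ y → sym (piecewise-+ N φ (N′ +_) y)) v) (Listₚ.map-∘ v)) ⟩
    sumℚ (map f (shuffles (map ψ u) (map ψ (map (N +_) v))))
  ≡⟨ shuffles-relabel f-invariant ψ u (map (N +_) v) (Admissible-cong (sym ∘ ψ≗φ) A) shifted-admissible (below-shifted u v) ψ-sep ⟩
    Δ f u v ∎
  where
  open ≡-Reasoning
  N N′ : ℕ
  N = suc (maxℕ u)
  N′ = suc (maxℕ (map φ u))
  ψ : ℕ → ℕ
  ψ = piecewise N φ (N′ +_)
  ψ≗φ : ∀ {a} → a ∈ u → ψ a ≡ φ a
  ψ≗φ a∈u = piecewise-< {low = φ} {high = N′ +_} (∈⇒<suc-maxℕ a∈u)
  ψ-sep : ∀ {a b} → a ∈ u → b ∈ map (N +_) v → ψ a < ψ b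
  ψ-sep a∈u b∈ with ∈ₚ.∈-map⁻ (N +_) b∈
  ... | y , _ , refl = subst₂ _<_ (sym (ψ≗φ a∈u)) (sym (piecewise-+ N φ (N′ +_) y))
                         (ℕₚ.<-≤-trans (∈⇒<suc-maxℕ (∈ₚ.∈-map⁺ φ a∈u)) (ℕₚ.m≤m+n N′ y))
  shifted-admissible : Admissible r ψ (map (N +_) v)
  shifted-admissible = strictMono⇒Admissible λ a∈ b∈ a<b → helper (∈ₚ.∈-map⁻ (N +_) a∈) (∈ₚ.∈-map⁻ (N +_) b∈) a<b
    where
    helper : ∀ {a b} → ∃ (λ x → x ∈ v × a ≡ N + x) → ∃ (λ y → y ∈ v × b ≡ N + y) → a < b → ψ a < ψ b
    helper (x , _ , refl) (y , _ , refl) a<b = subst₂ _<_ (sym (piecewise-+ N φ (N′ +_) x)) (sym (piecewise-+ N φ (N′ +_) y))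
      (ℕₚ.+-monoʳ-< N′ (ℕₚ.+-cancelˡ-< N x y a<b))

Δ-invariantʳ : ∀ {r f} → RelabellingInvariant r f → ∀ u → RelabellingInvariant r (Δ f u)
Δ-invariantʳ {r} {f} f-invariant u φ v A = begin
    Δ f u (map φ v)
  ≡⟨ cong₂ (λ u′ v′ → sumℚ (map f (shuffles u′ v′))) (sym (trans (Listₚ.map-cong-local (All.tabulate ψ≗id)) (Listₚ.map-id u)))
       (trans (sym (Listₚ.map-∘ v)) (trans (Listₚ.map-cong (λ y → sym (piecewise-+ N id (λ y → N + φ y) y)) v) (Listₚ.map-∘ v))) ⟩
    sumℚ (map f (shuffles (map ψ u) (map ψ (map (N +_) v))))
  ≡⟨ shuffles-relabel f-invariant ψ u (map (N +_) v)
       (strictMono⇒Admissible ψ-mono) (Admissible-shift N A (piecewise-+ N id _)) (below-shifted u v) ψ-sep ⟩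
    Δ f u v ∎
  where
  open ≡-Reasoning
  N : ℕ
  N = suc (maxℕ u)
  ψ : ℕ → ℕ
  ψ = piecewise N id (λ y → N + φ y)
  ψ≗id : ∀ {a} → a ∈ u → ψ a ≡ a
  ψ≗id a∈u = piecewise-< {low = id} {high = λ y → N + φ y} (∈⇒<suc-maxℕ a∈u)
  ψ-mono : ∀ {a b} → a ∈ u → b ∈ u → a < b → ψ a < ψ b
  ψ-mono a∈ b∈ = subst₂ _<_ (sym (ψ≗id a∈)) (sym (ψ≗id b∈))
  ψ-sep : ∀ {a b} → a ∈ u → b ∈ map (N +_) v → ψ a < ψ b
  ψ-sep a∈u b∈ with ∈ₚ.∈-map⁻ (N +_) b∈
  ... | y , _ , refl = subst₂ _<_ (sym (ψ≗id a∈u)) (sym (piecewise-+ N id (λ y → N + φ y) y))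
                         (ℕₚ.<-≤-trans (∈⇒<suc-maxℕ a∈u) (ℕₚ.m≤m+n N (φ y)))

length-shuffle : ∀ u v′ {s} → s ∈ shuffles u v′ → length s ≡ length u + length v′
length-shuffle u v′ s∈ = trans (↭ₚ.↭-length (shuffles-↭ u v′ s∈)) (Listₚ.length-++ u)

Δ-vanishesˡ : ∀ {D f} → VanishesAbove D f → ∀ v → VanishesAbove D (λ u → Δ f u v)
Δ-vanishesˡ f-vanishes v u D<|u| = sumℚ-map-zero (shuffles u _) (λ {s} s∈ →
  f-vanishes s (ℕₚ.<-≤-trans D<|u| (subst (length u ≤_) (sym (length-shuffle u _ s∈)) (ℕₚ.m≤m+n _ _))))

Δ-vanishesʳ : ∀ {D f} → VanishesAbove D f → ∀ u → VanishesAbove D (Δ f u)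
Δ-vanishesʳ f-vanishes u v D<|v| = sumℚ-map-zero (shuffles u v′) (λ {s} s∈ →
  f-vanishes s (ℕₚ.<-≤-trans D<|v| (subst (length v ≤_) (sym (trans (length-shuffle u v′ s∈) (cong (length u +_) (Listₚ.length-map _ v))))
                                          (ℕₚ.m≤n+m _ _))))
  where
  v′ : List ℕ
  v′ = map (suc (maxℕ u) +_) v

oneSeries∈NCQSymʳ : ∀ r → InNCQSymʳ r oneSeries
oneSeries∈NCQSymʳ r = ((0 , ∅) , 1ℚ) ∷ [] , λ { [] → refl ; (_ ∷ _) → refl }
  where
  ∅ : RSetComp r 0
  ∅ = record { Φ = [] ; Π = [] ; covers = ↭-refl ; Φ-large = [] ; Π-nonempty = [] ; Π-small = [] }

mainTheorem18 : (r : ℕ) → 1 ≤ r →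
    InNCQSymʳ r oneSeries
    × (∀ f g → InNCQSymʳ r f → InNCQSymʳ r g → InNCQSymʳ r (f ⋆ g))
    × (∀ f → InNCQSymʳ r f → InNCQSymʳ⊗NCQSymʳ r (Δ f))
mainTheorem18 r _ = oneSeries∈NCQSymʳ r , ⋆-closed , Δ-closed
  where
  open Spanning r
  ⋆-closed : ∀ f g → InNCQSymʳ r f → InNCQSymʳ r g → InNCQSymʳ r (f ⋆ g)
  ⋆-closed f g f∈ g∈ = invariant⇒InNCQSymʳ _
    (⋆-invariant (InNCQSymʳ⇒invariant f∈) (InNCQSymʳ⇒invariant g∈))
    (⋆-vanishesAbove (InNCQSymʳ⇒vanishesAbove f∈) (InNCQSymʳ⇒vanishesAbove g∈))
  Δ-closed : ∀ f → InNCQSymʳ r f → InNCQSymʳ⊗NCQSymʳ r (Δ f)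
  Δ-closed f f∈ = invariant²⇒InNCQSymʳ⊗NCQSymʳ _
    (Δ-invariantˡ f-invariant) (Δ-invariantʳ f-invariant) (Δ-vanishesˡ f-vanishes) (Δ-vanishesʳ f-vanishes)
    where
    f-invariant : RelabellingInvariant r f
    f-invariant = InNCQSymʳ⇒invariant f∈
    f-vanishes : VanishesAbove (degreeBound (proj₁ f∈)) f
    f-vanishes = InNCQSymʳ⇒vanishesAbove f∈
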